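{- Let $k\ge 13$ be an integer, let $n=3k+3$, let $b=\lceil (k+1)/2\rceil$, and consider the vertex $u_0$ of $\mathrm{GP}(n,2k+1)$. Then (all indices modulo $n$): (i) $S_1(u_0)=\{u_{\pm 1},v_0\}$, $S_2(u_0)=\{u_{\pm 2},v_{\pm 1},v_{\pm (k+2)}\}$, $S_3(u_0)=\{u_{\pm 3},u_{\pm (k+2)},v_{\pm 2},v_{\pm (k+1)},v_{\pm (k+3)},v_{\pm (k-1)}\}$, $S_4(u_0)=\{u_{\pm 4},u_{\pm (k-1)},u_{\pm (k+1)},u_{\pm 2k},v_{\pm 3},v_{\pm k},v_{\pm (k+4)},v_{\pm (k-2)}\}$, $S_5(u_0)=\{u_{\pm 5},u_{\pm k},u_{\pm (k+4)},u_{\pm (k-2)},v_{\pm 4},v_{\pm (k+5)},v_{\pm (k-3)}\}$; (ii) $S_i(u_0)=\{u_{\pm i},v_{\pm(i-1)},u_{\pm(k+i-1)},u_{\pm(2k+i)},v_{\pm(2k+i+1)},v_{\pm(k+i)}\}$ for $6\le i\le b$; (iii) if $k$ is odd, then $S_{b+1}(u_0)=\{u_{\pm(k+3)/2},v_{\pm(k+1)/2},u_{\pm(3k+1)/2},v_{(3k+3)/2}\}$, $S_{b+2}(u_0)=\{u_{(3k+3)/2}\}$, and $S_i(u_0)=\emptyset$ for $i>b+2$; (iv) if $k$ is even, then $S_{b+1}(u_0)=\{u_{\pm(3k+2)/2}\}$ and $S_i(u_0)=\emptyset$ for $i>b+1$.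
   Context: For $n\ge 3$ and $k\in\{1,\dots,n-1\}\setminus\{n/2\}$, the generalized Petersen graph $\mathrm{GP}(n,k)$ has vertex set $\{u_i\mid i\in\mathbb{Z}_n\}\cup\{v_i\mid i\in\mathbb{Z}_n\}$ and edges $u_iu_{i+1}$, $v_iv_{i+k}$, $u_iv_i$ for $i\in\mathbb{Z}_n$ (here the second parameter is $2k+1$, so the edges among the $v$'s are $v_iv_{i+2k+1}$). For a vertex $u$ and integer $i$, $S_i(u)$ is the set of vertices at path-length distance exactly $i$ from $u$. The notation $u_{\pm j}$ means both $u_j$ and $u_{ -j}$ (similarly for $v$). -}

module Defs where

open import Data.Nat using (ℕ; zero; suc; _<_; NonZero)
open import Data.Integer as ℤ using (ℤ; +_; _%ℕ_)
open import Data.Integer.DivMod using (n%ℕd<d)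
open import Data.Fin using (Fin; toℕ; fromℕ<)
open import Data.Sum using (_⊎_)
open import Data.Product using (_×_)
open import Data.List using (List; []; _∷_; _++_)
open import Data.List.Membership.Propositional using (_∈_)
open import Relation.Binary.PropositionalEquality using (_≡_)
open import Relation.Nullary using (¬_)

ix : (n : ℕ) .{{_ : NonZero n}} → ℤ → Fin n
ix n z = fromℕ< (n%ℕd<d z n)

data Vtx (n : ℕ) : Set where
  u : Fin n → Vtx n
  v : Fin n → Vtx n

shift : (n : ℕ) .{{_ : NonZero n}} → Fin n → ℕ → Fin n
shift n i m = ix n (+ toℕ i ℤ.+ + m)

Adj : (n s : ℕ) .{{_ : NonZero n}} → Vtx n → Vtx n → Set
Adj n s (u i) (u j) = (j ≡ shift n i 1) ⊎ (i ≡ shift n j 1)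
Adj n s (v i) (v j) = (j ≡ shift n i s) ⊎ (i ≡ shift n j s)
Adj n s (u i) (v j) = i ≡ j
Adj n s (v i) (u j) = i ≡ j

data Walk (n s : ℕ) .{{_ : NonZero n}} (x : Vtx n) : Vtx n → ℕ → Set where
  nil  : Walk n s x x zero
  step : ∀ {y z m} → Walk n s x y m → Adj n s y z → Walk n s x z (suc m)

InSphere : (n s : ℕ) .{{_ : NonZero n}} → Vtx n → ℕ → Vtx n → Set
InSphere n s x d y = Walk n s x y d × (∀ j → j < d → ¬ Walk n s x y j)

SphereIs : (n s : ℕ) .{{_ : NonZero n}} → Vtx n → ℕ → List (Vtx n) → Set
SphereIs n s x d L = ∀ y → (InSphere n s x d y → y ∈ L) × (y ∈ L → InSphere n s x d y)

N : ℕ → ℕ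
N k = suc (suc (suc (3 Data.Nat.* k)))

S2 : ℕ → ℕ
S2 k = suc (2 Data.Nat.* k)

U V : (k : ℕ) → ℤ → Vtx (N k)
U k j = u (ix (N k) j)
V k j = v (ix (N k) j)

U± V± : (k : ℕ) → ℤ → List (Vtx (N k))
U± k j = U k j ∷ U k (ℤ.- j) ∷ []
V± k j = V k j ∷ V k (ℤ.- j) ∷ []

Sph : (k d : ℕ) → List (Vtx (N k)) → Set
Sph k d L = SphereIs (N k) (S2 k) (U k (+ 0)) d L

-- Write r = t ⊓ (n ∸ t) for the radius of an index t of ℤ_n, n = 3k + 3.  An inner edge of
-- GP(n, 2k + 1) moves by 2k + 1 ≡ -(k + 2) and two of them move by k - 1, so the distance from u_0 is
--   d(u_t) = min (r, 3 + |r - (k + 2)|, 4 + |r - (k - 1)|),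
--   d(v_t) = min (r + 1, 2 + |r - (k + 2)|, 3 + |r - (k - 1)|).
-- Walks along the rim followed by a spoke and at most two inner edges, together with the reflection
-- t ↦ -t, realise these lengths; conversely the formula changes by at most one along every edge and
-- vanishes at u_0, so no walk is shorter.  Every sphere is then read off by solving d = i for r.

module Submission where

open import Defs
open import Data.Nat as ℕ using (ℕ; zero; suc; _+_; _*_; _∸_; _≤_; _<_; _⊓_; z≤n; s≤s; ∣_-_∣; _≤?_; _<?_; _%_; _/_; ⌊_/2⌋; ⌈_/2⌉; NonZero)
open import Data.Nat.Properties
open import Data.Nat.DivMod
open import Data.Nat.Tactic.RingSolver
open import Data.Fin using (Fin; toℕ)
import Data.Fin.Properties as FP
open import Data.Integer as ℤ using (ℤ; +_; -[1+_]; _%ℕ_)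
open import Data.Integer.DivMod using (n%ℕd<d)
open import Data.List using (List; []; _∷_; _++_)
open import Data.List.Membership.Propositional using (_∈_)
open import Data.List.Relation.Unary.Any using (here; there)
open import Data.Product using (Σ-syntax; ∃; ∃₂; _×_; _,_; proj₁; proj₂)
open import Data.Sum using (_⊎_; inj₁; inj₂)
open import Data.Empty using (⊥; ⊥-elim)
open import Function using (_∘_)
open import Relation.Binary.PropositionalEquality
open import Relation.Binary.Definitions using (tri<; tri≈; tri>)
open import Relation.Nullary using (¬_; Dec; yes; no)

m+n≡o⇒m≤o : ∀ {m n o} → m + n ≡ o → m ≤ o
m+n≡o⇒m≤o {m} e = m+n≤o⇒m≤o m (≤-reflexive e)

≤-certified : ∀ {P Q X Y} m c → X ≤ Y → suc m * Q + X ≡ suc m * P + Y + c → P ≤ Q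
≤-certified {P} {Q} {X} {Y} m c X≤Y e = *-cancelˡ-≤ (suc m) (+-cancelʳ-≤ X (suc m * P) (suc m * Q)
  (≤-trans (+-monoʳ-≤ (suc m * P) X≤Y) (m+n≡o⇒m≤o {n = c} (sym e))))

∸-suc-≤ : ∀ m n → m ∸ n ≤ suc (m ∸ suc n)
∸-suc-≤ zero n = subst (_≤ 1) (sym (0∸n≡0 n)) z≤n
∸-suc-≤ (suc m) zero = ≤-refl
∸-suc-≤ (suc m) (suc n) = ∸-suc-≤ m n

∣m-n∣≤1 : ∀ {m n} → m ≤ suc n → n ≤ suc m → ∣ m - n ∣ ≤ 1
∣m-n∣≤1 {m} {n} m≤1+n n≤1+m with ≤-total m n
... | inj₁ m≤n = subst (_≤ 1) (sym (m≤n⇒∣m-n∣≡n∸m m≤n)) (≤-trans (∸-monoˡ-≤ m n≤1+m) (≤-reflexive (m+n∸n≡m 1 m)))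
... | inj₂ n≤m = subst (_≤ 1) (sym (m≤n⇒∣n-m∣≡n∸m n≤m)) (≤-trans (∸-monoˡ-≤ n m≤1+n) (≤-reflexive (m+n∸n≡m 1 n)))

∣-∣-exchange : ∀ a b c d → a + b ≡ c + d → ∣ b - c ∣ ≡ ∣ a - d ∣
∣-∣-exchange a b c d e = begin
  ∣ b - c ∣          ≡⟨ ∣m+n-m+o∣≡∣n-o∣ a b c ⟨
  ∣ a + b - a + c ∣  ≡⟨ cong₂ ∣_-_∣ e (+-comm a c) ⟩
  ∣ c + d - c + a ∣  ≡⟨ ∣m+n-m+o∣≡∣n-o∣ c d a ⟩
  ∣ d - a ∣          ≡⟨ ∣-∣-comm d a ⟩
  ∣ a - d ∣          ∎
  where open ≡-Reasoning

∣m+n-m∣≡n : ∀ m n → ∣ m + n - m ∣ ≡ n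
∣m+n-m∣≡n m n = trans (∣-∣-comm (m + n) m) (∣m-m+n∣≡n m n)

∣n+m-m∣≡n : ∀ m n → ∣ n + m - m ∣ ≡ n
∣n+m-m∣≡n m n = trans (cong (λ z → ∣ z - m ∣) (+-comm n m)) (∣m+n-m∣≡n m n)

∣m-[n+m]∣≡n : ∀ m n → ∣ m - (n + m) ∣ ≡ n
∣m-[n+m]∣≡n m n = trans (cong (λ z → ∣ m - z ∣) (+-comm n m)) (∣m-m+n∣≡n m n)

m∸n≤∣n-m∣ : ∀ m n → m ∸ n ≤ ∣ n - m ∣
m∸n≤∣n-m∣ m n = subst (m ∸ n ≤_) (∣-∣-comm m n) (m∸n≤∣m-n∣ m n)

≤-⊓₃ : ∀ {x p q w} → x ≤ p → x ≤ q → x ≤ w → x ≤ (p ⊓ q) ⊓ w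
≤-⊓₃ x≤p x≤q x≤w = ⊓-glb (⊓-glb x≤p x≤q) x≤w

⌊n/2⌋+⌊n/2⌋≤n : ∀ n → ⌊ n /2⌋ + ⌊ n /2⌋ ≤ n
⌊n/2⌋+⌊n/2⌋≤n n = ≤-trans (+-monoʳ-≤ ⌊ n /2⌋ (⌊n/2⌋≤⌈n/2⌉ n)) (≤-reflexive (⌊n/2⌋+⌈n/2⌉≡n n))

infixr 5 _∷≡_
_∷≡_ : ∀ {A : Set} {x y : A} {xs ys} → x ≡ y → xs ≡ ys → x ∷ xs ≡ y ∷ ys
_∷≡_ = cong₂ _∷_

module GeneralisedPetersen (n s : ℕ) .{{_ : NonZero n}} where

  at : ℕ → Fin n
  at a = ix n (+ a)

  toℕ-at : ∀ a → toℕ (at a) ≡ a % n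
  toℕ-at a = FP.toℕ-fromℕ< _

  at-cong : ∀ {a b} → a % n ≡ b % n → at a ≡ at b
  at-cong {a} {b} e = FP.toℕ-injective (trans (toℕ-at a) (trans e (sym (toℕ-at b))))

  at-toℕ : ∀ i → at (toℕ i) ≡ i
  at-toℕ i = FP.toℕ-injective (trans (toℕ-at (toℕ i)) (m<n⇒m%n≡m (FP.toℕ<n i)))

  at-+n : ∀ a → at (a + n) ≡ at a
  at-+n a = at-cong ([m+n]%n≡m%n a n)

  %-absorbˡ : ∀ a m → (a % n + m) % n ≡ (a + m) % n
  %-absorbˡ a m = begin
    (a % n + m) % n           ≡⟨ %-distribˡ-+ (a % n) m n ⟩
    (a % n % n + m % n) % n   ≡⟨ cong (λ z → (z + m % n) % n) (m%n%n≡m%n a n) ⟩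
    (a % n + m % n) % n       ≡⟨ %-distribˡ-+ a m n ⟨
    (a + m) % n               ∎
    where open ≡-Reasoning

  shift-at : ∀ a m → shift n (at a) m ≡ at (a + m)
  shift-at a m = at-cong (trans (cong (λ z → (z + m) % n) (toℕ-at a)) (%-absorbˡ a m))

  0%n≡0 : 0 % n ≡ 0
  0%n≡0 = m<n⇒m%n≡m (ℕ.>-nonZero⁻¹ n)

  half<n : ∀ a → a + a ≤ n → a < n
  half<n zero _ = ℕ.>-nonZero⁻¹ n
  half<n (suc a) 2a≤n = ≤-trans (s≤s (m≤m+n (suc a) a)) (subst (_≤ n) (+-suc (suc a) a) 2a≤n)

  neg : Fin n → Fin n
  neg i = at (n ∸ toℕ i)

  -- with (i + m) % n + q n = i + m, both sides are (n ∸ i) + q n modulo n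
  neg-shift : ∀ i m → neg i ≡ shift n (neg (shift n i m)) m
  neg-shift i m = at-cong (begin
    (n ∸ t) % n                      ≡⟨ [m+kn]%n≡m%n (n ∸ t) q n ⟨
    (n ∸ t + q * n) % n              ≡⟨ cong (_% n) (+-cancelʳ-≡ t _ _ key) ⟨
    (n ∸ j + m) % n                  ≡⟨ %-absorbˡ (n ∸ j) m ⟨
    ((n ∸ j) % n + m) % n            ≡⟨ cong (λ z → (z + m) % n) (toℕ-at (n ∸ j)) ⟨
    (toℕ (neg (shift n i m)) + m) % n ∎)
    where
      open ≡-Reasoning
      t j q : ℕ
      t = toℕ i
      j = toℕ (shift n i m)
      q = (t + m) / n
      balance : ∀ a b j t m p → a + j ≡ b + t → j + p ≡ t + m → a + m + t ≡ b + p + t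
      balance a b j t m p e f = +-cancelʳ-≡ j _ _ (begin
        a + m + t + j       ≡⟨ regroup₁ a m t j ⟩
        (a + j) + (t + m)   ≡⟨ cong₂ _+_ e (sym f) ⟩
        (b + t) + (j + p)   ≡⟨ regroup₂ b t j p ⟩
        b + p + t + j       ∎)
        where
          regroup₁ : ∀ a m t j → a + m + t + j ≡ (a + j) + (t + m)
          regroup₁ = solve-∀
          regroup₂ : ∀ b t j p → (b + t) + (j + p) ≡ b + p + t + j
          regroup₂ = solve-∀
      key : n ∸ j + m + t ≡ n ∸ t + q * n + t
      key = balance (n ∸ j) (n ∸ t) j t m (q * n)
              (trans (m∸n+n≡m (<⇒≤ (FP.toℕ<n (shift n i m)))) (sym (m∸n+n≡m (<⇒≤ (FP.toℕ<n i)))))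
              (trans (cong (_+ q * n) (toℕ-at (t + m))) (sym (m≡m%n+[m/n]*n (t + m) n)))

  neg-at∸ : ∀ t → t ≤ n → neg (at (n ∸ t)) ≡ at t
  neg-at∸ zero _ = at-cong (begin
    (n ∸ toℕ (at n)) % n  ≡⟨ cong (λ z → (n ∸ z) % n) (trans (toℕ-at n) (n%n≡0 n)) ⟩
    n % n                 ≡⟨ n%n≡0 n ⟩
    0                     ≡⟨ 0%n≡0 ⟨
    0 % n                 ∎)
    where open ≡-Reasoning
  neg-at∸ (suc t) t<n = at-cong (cong (_% n) (begin
    n ∸ toℕ (at (n ∸ suc t))  ≡⟨ cong (n ∸_) (trans (toℕ-at (n ∸ suc t)) (m<n⇒m%n≡m (∸-monoʳ-< (s≤s z≤n) t<n))) ⟩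
    n ∸ (n ∸ suc t)           ≡⟨ m∸[m∸n]≡n t<n ⟩
    suc t                     ∎))
    where open ≡-Reasoning

  neg-involutive : ∀ i → neg (neg i) ≡ i
  neg-involutive i = trans (neg-at∸ (toℕ i) (<⇒≤ (FP.toℕ<n i))) (at-toℕ i)

  neg-at0 : neg (at 0) ≡ at 0
  neg-at0 = trans (cong (neg ∘ at) (sym (n∸n≡0 n))) (trans (neg-at∸ n ≤-refl) (at-+n 0))

  neg-at-half : ∀ h → h + h ≡ n → neg (at h) ≡ at h
  neg-at-half h 2h≡n = at-cong (cong (_% n) (begin
    n ∸ toℕ (at h)   ≡⟨ cong (n ∸_) (trans (toℕ-at h) (m<n⇒m%n≡m (half<n h (≤-reflexive 2h≡n)))) ⟩
    n ∸ h            ≡⟨ cong (_∸ h) (sym 2h≡n) ⟩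
    h + h ∸ h        ≡⟨ m+n∸n≡m h h ⟩
    h                ∎))
    where open ≡-Reasoning

  ix-neg : ∀ z → ix n (ℤ.- z) ≡ neg (ix n z)
  ix-neg z = FP.toℕ-injective (begin
    toℕ (ix n (ℤ.- z))          ≡⟨ FP.toℕ-fromℕ< _ ⟩
    (ℤ.- z) %ℕ n                ≡⟨ -z%ℕn z ⟩
    (n ∸ z %ℕ n) % n            ≡⟨ cong (λ x → (n ∸ x) % n) (FP.toℕ-fromℕ< (n%ℕd<d z n)) ⟨
    (n ∸ toℕ (ix n z)) % n      ≡⟨ toℕ-at _ ⟨
    toℕ (neg (ix n z))          ∎)
    where
      open ≡-Reasoning
      -z%ℕn : ∀ z → (ℤ.- z) %ℕ n ≡ (n ∸ z %ℕ n) % n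
      -z%ℕn (+ zero) = begin
        0 % n            ≡⟨ 0%n≡0 ⟩
        0                ≡⟨ n%n≡0 n ⟨
        n % n            ≡⟨ cong (λ z → (n ∸ z) % n) 0%n≡0 ⟨
        (n ∸ 0 % n) % n  ∎
      -z%ℕn (+ suc a) with suc a % n | m%n<n (suc a) n
      ... | zero  | _  = sym (n%n≡0 n)
      ... | suc r | lt = sym (m<n⇒m%n≡m (∸-monoʳ-< (s≤s z≤n) (<⇒≤ lt)))
      -z%ℕn -[1+ a ] with suc a % n | m%n<n (suc a) n
      ... | zero  | _  = sym (n%n≡0 n)
      ... | suc r | lt = sym (trans (cong (_% n) (m∸[m∸n]≡n (<⇒≤ lt))) (m<n⇒m%n≡m lt))

  reflect : Vtx n → Vtx n
  reflect (u i) = u (neg i)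
  reflect (v i) = v (neg i)

  reflect-adj : ∀ {y z} → Adj n s y z → Adj n s (reflect y) (reflect z)
  reflect-adj {u i} {u j} (inj₁ refl) = inj₂ (neg-shift i 1)
  reflect-adj {u i} {u j} (inj₂ refl) = inj₁ (neg-shift j 1)
  reflect-adj {v i} {v j} (inj₁ refl) = inj₂ (neg-shift i s)
  reflect-adj {v i} {v j} (inj₂ refl) = inj₁ (neg-shift j s)
  reflect-adj {u i} {v j} refl = refl
  reflect-adj {v i} {u j} refl = refl

  reflect-walk : ∀ {x y m} → Walk n s x y m → Walk n s (reflect x) (reflect y) m
  reflect-walk nil = nil
  reflect-walk (step w e) = step (reflect-walk w) (reflect-adj e)

  radius : ℕ → ℕ
  radius t = t ⊓ (n ∸ t)

  radius≡ : ∀ {t} → t ≤ n ∸ t → radius t ≡ t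
  radius≡ = m≤n⇒m⊓n≡m

  radius≡∸ : ∀ {t} → n ∸ t ≤ t → radius t ≡ n ∸ t
  radius≡∸ = m≥n⇒m⊓n≡n

  radius-half : ∀ t → t ≤ n → radius t + radius t ≤ n
  radius-half t t≤n = ≤-trans (+-mono-≤ (m⊓n≤m t _) (m⊓n≤n t _)) (≤-reflexive (m+[n∸m]≡n t≤n))

  radius-% : ∀ a → a + a ≤ n → radius (a % n) ≡ a
  radius-% a 2a≤n = trans (cong radius (m<n⇒m%n≡m (half<n a 2a≤n))) (radius≡ (m+n≤o⇒m≤o∸n a 2a≤n))

  radius-%-opposite : ∀ a b → a + b ≡ n → 0 < b → b ≤ a → radius (a % n) ≡ b
  radius-%-opposite a b a+b≡n 0<b b≤a =
    trans (cong radius (m<n⇒m%n≡m a<n)) (trans (radius≡∸ (subst (_≤ a) (sym n∸a≡b) b≤a)) n∸a≡b)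
    where
      a<n : a < n
      a<n = subst (a <_) a+b≡n (subst (_≤ a + b) (+-comm a 1) (+-monoʳ-≤ a 0<b))
      n∸a≡b : n ∸ a ≡ b
      n∸a≡b = trans (cong (_∸ a) (sym a+b≡n)) (m+n∸m≡n a b)

  at-radius⊎neg : ∀ i → i ≡ at (radius (toℕ i)) ⊎ i ≡ neg (at (radius (toℕ i)))
  at-radius⊎neg i with ⊓-sel (toℕ i) (n ∸ toℕ i)
  ... | inj₁ e = inj₁ (trans (sym (at-toℕ i)) (cong at (sym e)))
  ... | inj₂ e = inj₂ (sym (trans (cong (neg ∘ at) e) (trans (neg-at∸ (toℕ i) (<⇒≤ (FP.toℕ<n i))) (at-toℕ i))))

  radius-neg : ∀ i → radius (toℕ (neg i)) ≡ radius (toℕ i)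
  radius-neg i = trans (cong radius (toℕ-at (n ∸ toℕ i))) (radius-∸ (toℕ i) (FP.toℕ<n i))
    where
      radius-∸ : ∀ t → t < n → radius ((n ∸ t) % n) ≡ radius t
      radius-∸ zero _ = begin
        radius (n % n)   ≡⟨ cong radius (n%n≡0 n) ⟩
        0 ⊓ n            ≡⟨ ⊓-zeroˡ n ⟩
        0                ≡⟨ ⊓-zeroˡ (n ∸ 0) ⟨
        radius 0         ∎
        where open ≡-Reasoning
      radius-∸ (suc t) t<n = begin
        radius ((n ∸ suc t) % n)         ≡⟨ cong radius (m<n⇒m%n≡m (∸-monoʳ-< (s≤s z≤n) (<⇒≤ t<n))) ⟩
        (n ∸ suc t) ⊓ (n ∸ (n ∸ suc t))  ≡⟨ cong ((n ∸ suc t) ⊓_) (m∸[m∸n]≡n (<⇒≤ t<n)) ⟩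
        (n ∸ suc t) ⊓ suc t              ≡⟨ ⊓-comm (n ∸ suc t) (suc t) ⟩
        radius (suc t)                   ∎
        where open ≡-Reasoning

  radius-injective : ∀ i j → radius (toℕ i) ≡ radius (toℕ j) → i ≡ j ⊎ i ≡ neg j
  radius-injective i j e with at-radius⊎neg i | at-radius⊎neg j
  ... | inj₁ p | inj₁ q = inj₁ (trans p (trans (cong at e) (sym q)))
  ... | inj₁ p | inj₂ q = inj₂ (trans p (trans (cong at e) (trans (sym (neg-involutive _)) (cong neg (sym q)))))
  ... | inj₂ p | inj₁ q = inj₂ (trans p (trans (cong (neg ∘ at) e) (cong neg (sym q))))
  ... | inj₂ p | inj₂ q = inj₁ (trans p (trans (cong (neg ∘ at) e) (sym q)))

  radius-suc : ∀ t → t < n → ∣ radius ((t + 1) % n) - radius t ∣ ≤ 1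
  radius-suc t t<n with m≤n⇒m<n∨m≡n t<n
  ... | inj₁ 1+t<n = subst (λ z → ∣ radius z - radius t ∣ ≤ 1) (sym (m<n⇒m%n≡m (subst (_< n) (+-comm 1 t) 1+t<n)))
                       (∣m-n∣≤1 up down)
    where
      up : radius (t + 1) ≤ suc (radius t)
      up = ⊓-mono-≤ (≤-reflexive (+-comm t 1)) (≤-trans (∸-monoʳ-≤ n (m≤m+n t 1)) (n≤1+n _))
      down : radius t ≤ suc (radius (t + 1))
      down = ⊓-mono-≤ (≤-trans (m≤m+n t 1) (n≤1+n _)) (subst (λ z → n ∸ t ≤ suc (n ∸ z)) (+-comm 1 t) (∸-suc-≤ n t))
  ... | inj₂ 1+t≡n = subst (λ z → ∣ radius z - radius t ∣ ≤ 1) (sym wraps) radius-t≤1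
    where
      wraps : (t + 1) % n ≡ 0
      wraps = trans (cong (_% n) (trans (+-comm t 1) 1+t≡n)) (n%n≡0 n)
      radius-t≤1 : ∣ radius 0 - radius t ∣ ≤ 1
      radius-t≤1 = subst (λ z → ∣ z - radius t ∣ ≤ 1) (sym (⊓-zeroˡ (n ∸ 0)))
                     (≤-trans (m⊓n≤n t (n ∸ t)) (≤-reflexive (trans (cong (_∸ t) (sym 1+t≡n)) (m+n∸n≡m 1 t))))

  -- the possible radii a, b of two points t and t - c of ℤ_n
  Offset : ℕ → ℕ → ℕ → Set
  Offset c a b = (a + b ≡ c) ⊎ (a ≡ b + c) ⊎ (b ≡ a + c) ⊎ (a + b + c ≡ n)

  Offset-sym : ∀ {c a b} → Offset c a b → Offset c b a
  Offset-sym {c} {a} {b} (inj₁ e) = inj₁ (trans (+-comm b a) e)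
  Offset-sym (inj₂ (inj₁ e)) = inj₂ (inj₂ (inj₁ e))
  Offset-sym (inj₂ (inj₂ (inj₁ e))) = inj₂ (inj₁ e)
  Offset-sym {c} {a} {b} (inj₂ (inj₂ (inj₂ e))) = inj₂ (inj₂ (inj₂ (trans (cong (_+ c) (+-comm b a)) e)))

  radius-offset-wrapping : ∀ c t → c + c ≤ n → t < c → Offset c (radius t) (radius ((t + (n ∸ c)) % n))
  radius-offset-wrapping c t 2c≤n t<c = subst (λ z → Offset c (radius t) (radius z)) (sym (m<n⇒m%n≡m t'<n))
                                          (inj₁ (trans (cong₂ _+_ (radius≡ t≤n∸t) (radius≡∸ n∸t'≤t')) sum))
    where
      open ≡-Reasoning
      t' : ℕ
      t' = t + (n ∸ c)
      c≤n : c ≤ n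
      c≤n = ≤-trans (m≤m+n c c) 2c≤n
      t≤n∸t : t ≤ n ∸ t
      t≤n∸t = m+n≤o⇒m≤o∸n t (≤-trans (+-mono-≤ (<⇒≤ t<c) (<⇒≤ t<c)) 2c≤n)
      t'<n : t' < n
      t'<n = <-≤-trans (+-monoˡ-< (n ∸ c) t<c) (≤-reflexive (m+[n∸m]≡n c≤n))
      sum : t + (n ∸ t') ≡ c
      sum = +-cancelʳ-≡ (n ∸ c) _ _ (begin
        t + (n ∸ t') + (n ∸ c)    ≡⟨ +-assoc t (n ∸ t') (n ∸ c) ⟩
        t + ((n ∸ t') + (n ∸ c))  ≡⟨ cong (λ z → t + z) (+-comm (n ∸ t') (n ∸ c)) ⟩
        t + ((n ∸ c) + (n ∸ t'))  ≡⟨ +-assoc t (n ∸ c) (n ∸ t') ⟨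
        t' + (n ∸ t')             ≡⟨ m+[n∸m]≡n (<⇒≤ t'<n) ⟩
        n                         ≡⟨ m+[n∸m]≡n c≤n ⟨
        c + (n ∸ c)               ∎)
      n∸t'≤t' : n ∸ t' ≤ t'
      n∸t'≤t' = ≤-trans (m+n≡o⇒m≤o (trans (+-comm (n ∸ t') t) sum))
                  (≤-trans (m+n≤o⇒m≤o∸n c 2c≤n) (m≤n+m (n ∸ c) t))

  radius-offset-direct : ∀ c t → c ≤ t → t < n → Offset c (radius t) (radius ((t + (n ∸ c)) % n))
  radius-offset-direct c t c≤t t<n = subst (λ z → Offset c (radius t) (radius z)) (sym t'≡p) (cases (t ≤? n ∸ t) (p ≤? n ∸ p))
    where
      p : ℕ
      p = t ∸ c
      p+c≡t : p + c ≡ t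
      p+c≡t = m∸n+n≡m c≤t
      p≤t : p ≤ t
      p≤t = m∸n≤m t c
      p<n : p < n
      p<n = ≤-<-trans p≤t t<n
      t'≡p : (t + (n ∸ c)) % n ≡ p
      t'≡p = begin
        (t + (n ∸ c)) % n        ≡⟨ cong (λ z → (z + (n ∸ c)) % n) p+c≡t ⟨
        (p + c + (n ∸ c)) % n    ≡⟨ cong (_% n) (+-assoc p c (n ∸ c)) ⟩
        (p + (c + (n ∸ c))) % n  ≡⟨ cong (λ z → (p + z) % n) (m+[n∸m]≡n (≤-trans c≤t (<⇒≤ t<n))) ⟩
        (p + n) % n              ≡⟨ [m+n]%n≡m%n p n ⟩
        p % n                    ≡⟨ m<n⇒m%n≡m p<n ⟩
        p                        ∎
        where open ≡-Reasoning
      cases : Dec (t ≤ n ∸ t) → Dec (p ≤ n ∸ p) → Offset c (radius t) (radius p)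
      cases (yes t-near) (yes p-near) = subst₂ (Offset c) (sym (radius≡ t-near)) (sym (radius≡ p-near)) (inj₂ (inj₁ (sym p+c≡t)))
      cases (yes t-near) (no p-far) = ⊥-elim (p-far (≤-trans p≤t (≤-trans t-near (∸-monoʳ-≤ n p≤t))))
      cases (no t-far) (yes p-near) = subst₂ (Offset c) (sym (radius≡∸ (<⇒≤ (≰⇒> t-far)))) (sym (radius≡ p-near))
                                        (inj₂ (inj₂ (inj₂ wrapped)))
        where
          wrapped : n ∸ t + p + c ≡ n
          wrapped = trans (+-assoc (n ∸ t) p c) (trans (cong (λ z → n ∸ t + z) p+c≡t) (m∸n+n≡m (<⇒≤ t<n)))
      cases (no t-far) (no p-far) = subst₂ (Offset c) (sym (radius≡∸ (<⇒≤ (≰⇒> t-far)))) (sym (radius≡∸ (<⇒≤ (≰⇒> p-far))))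
                                      (inj₂ (inj₂ (inj₁ (+-cancelʳ-≡ p _ _ (trans (m∸n+n≡m (<⇒≤ p<n)) (sym shifted))))))
        where
          shifted : n ∸ t + c + p ≡ n
          shifted = trans (+-assoc (n ∸ t) c p) (trans (cong (λ z → n ∸ t + z) (trans (+-comm c p) p+c≡t)) (m∸n+n≡m (<⇒≤ t<n)))

  radius-offset : ∀ c t → c + c ≤ n → t < n → Offset c (radius t) (radius ((t + (n ∸ c)) % n))
  radius-offset c t 2c≤n t<n with c ≤? t
  ... | no c≰t = radius-offset-wrapping c t 2c≤n (≰⇒> c≰t)
  ... | yes c≤t = radius-offset-direct c t c≤t t<n

  Walk₀ : Vtx n → ℕ → Set
  Walk₀ = Walk n s (u (at 0))

  retype : ∀ {y y' m m'} → y ≡ y' → m ≡ m' → Walk₀ y m → Walk₀ y' m'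
  retype refl refl w = w

  walk-⊓ : ∀ {y a b} → Walk₀ y a → Walk₀ y b → Walk₀ y (a ⊓ b)
  walk-⊓ {a = a} {b} wa wb with ⊓-sel a b
  ... | inj₁ e = retype refl (sym e) wa
  ... | inj₂ e = retype refl (sym e) wb

  reflect-walk₀ : ∀ {y m} → Walk₀ y m → Walk₀ (reflect y) m
  reflect-walk₀ {y} {m} w = subst (λ x → Walk n s (u x) (reflect y) m) neg-at0 (reflect-walk w)

  +spoke : ∀ {i m} → Walk₀ (u i) m → Walk₀ (v i) (suc m)
  +spoke w = step w refl

  +spoke⁻ : ∀ {i m} → Walk₀ (v i) m → Walk₀ (u i) (suc m)
  +spoke⁻ w = step w refl

  +inner : ∀ a {m} → Walk₀ (v (at a)) m → Walk₀ (v (at (a + s))) (suc m)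
  +inner a w = step w (inj₁ (sym (shift-at a s)))

  +inner⁻ : ∀ c → c + s ≡ n → ∀ a {m} → Walk₀ (v (at a)) m → Walk₀ (v (at (a + c))) (suc m)
  +inner⁻ c e a w = step w (inj₂ (sym (begin
    shift n (at (a + c)) s  ≡⟨ shift-at (a + c) s ⟩
    at (a + c + s)          ≡⟨ cong at (trans (+-assoc a c s) (cong (λ x → a + x) e)) ⟩
    at (a + n)              ≡⟨ at-+n a ⟩
    at a                    ∎)))
    where open ≡-Reasoning

  rim-forward : ∀ a → Walk₀ (u (at a)) a
  rim-forward zero = nil
  rim-forward (suc a) = step (rim-forward a) (inj₁ (sym (trans (shift-at a 1) (cong at (+-comm a 1)))))

  rim-backward : ∀ a → a ≤ n → Walk₀ (u (at (n ∸ a))) a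
  rim-backward a a≤n = retype (cong u neg-at) refl (reflect-walk₀ (rim-forward a))
    where
      neg-at : neg (at a) ≡ at (n ∸ a)
      neg-at = trans (cong (neg ∘ at) (sym (m∸[m∸n]≡n a≤n))) (neg-at∸ (n ∸ a) (m∸n≤m n a))

  rim-offset : ∀ r c → c ≤ n → Σ[ x ∈ ℕ ] Walk₀ (u (at x)) ∣ r - c ∣ × at (x + c) ≡ at r
  rim-offset r c c≤n with c ≤? r
  ... | yes c≤r = r ∸ c , retype refl (sym (m≤n⇒∣n-m∣≡n∸m c≤r)) (rim-forward (r ∸ c)) ,
                  cong at (m∸n+n≡m c≤r)
  ... | no c≰r = n ∸ (c ∸ r) , retype refl (sym (m≤n⇒∣m-n∣≡n∸m r≤c)) (rim-backward (c ∸ r) c∸r≤n) ,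
                 trans (cong at wraps) (at-+n r)
    where
      r≤c : r ≤ c
      r≤c = <⇒≤ (≰⇒> c≰r)
      c∸r≤n : c ∸ r ≤ n
      c∸r≤n = ≤-trans (m∸n≤m c r) c≤n
      wraps : n ∸ (c ∸ r) + c ≡ r + n
      wraps = begin
        n ∸ (c ∸ r) + c               ≡⟨ cong (λ z → n ∸ (c ∸ r) + z) (m∸n+n≡m r≤c) ⟨
        n ∸ (c ∸ r) + (c ∸ r + r)     ≡⟨ +-assoc (n ∸ (c ∸ r)) (c ∸ r) r ⟨
        n ∸ (c ∸ r) + (c ∸ r) + r     ≡⟨ cong (_+ r) (m∸n+n≡m c∸r≤n) ⟩
        n + r                         ≡⟨ +-comm n r ⟩
        r + n                         ∎
        where open ≡-Reasoning

distU : ℕ → ℕ → ℕ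
distU k r = (r ⊓ (3 + ∣ r - (2 + k) ∣)) ⊓ (4 + ∣ r - (k ∸ 1) ∣)

distV : ℕ → ℕ → ℕ
distV k r = (suc r ⊓ (2 + ∣ r - (2 + k) ∣)) ⊓ (3 + ∣ r - (k ∸ 1) ∣)

module Graph (k : ℕ) where
  open GeneralisedPetersen (N k) (S2 k) public

  dist : Vtx (N k) → ℕ
  dist (u i) = distU k (radius (toℕ i))
  dist (v i) = distV k (radius (toℕ i))

  s+[2+k]≡n : S2 k + (2 + k) ≡ N k
  s+[2+k]≡n = lemma k
    where lemma : ∀ k → suc (2 * k) + (2 + k) ≡ suc (suc (suc (3 * k)))
          lemma = solve-∀

  [2+k]+s≡n : 2 + k + S2 k ≡ N k
  [2+k]+s≡n = trans (+-comm (2 + k) (S2 k)) s+[2+k]≡n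

  s+s≡[k∸1]+n : 1 ≤ k → S2 k + S2 k ≡ k ∸ 1 + N k
  s+s≡[k∸1]+n (s≤s {n = k'} z≤n) = lemma k'
    where lemma : ∀ k' → suc (2 * suc k') + suc (2 * suc k') ≡ k' + suc (suc (suc (3 * suc k')))
          lemma = solve-∀

  2+k≤n : 2 + k ≤ N k
  2+k≤n = ≤-trans (m≤m+n (2 + k) (S2 k)) (≤-reflexive [2+k]+s≡n)

  k∸1≤n : k ∸ 1 ≤ N k
  k∸1≤n = ≤-trans (m∸n≤m k 1) (≤-trans (m≤n+m k 2) 2+k≤n)

  walk-v-spoke : ∀ r → Walk₀ (v (at r)) (suc r)
  walk-v-spoke r = +spoke (rim-forward r)

  -- u_x, v_x, v_{x + (k + 2)}, with x + (k + 2) ≡ r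
  walk-v-inner : ∀ r → Walk₀ (v (at r)) (2 + ∣ r - (2 + k) ∣)
  walk-v-inner r with rim-offset r (2 + k) 2+k≤n
  ... | x , w , e = retype (cong v e) refl (+inner⁻ (2 + k) [2+k]+s≡n x (+spoke w))

  -- u_x, v_x, v_{x + s}, v_{x + 2s}, with x + 2s ≡ x + (k - 1) ≡ r
  walk-v-inner² : 1 ≤ k → ∀ r → Walk₀ (v (at r)) (3 + ∣ r - (k ∸ 1) ∣)
  walk-v-inner² 1≤k r with rim-offset r (k ∸ 1) k∸1≤n
  ... | x , w , e = retype (cong v (trans x+2s≡ e)) refl
                      (+inner (x + S2 k) (+inner x (+spoke w)))
    where
      x+2s≡ : at (x + S2 k + S2 k) ≡ at (x + (k ∸ 1))
      x+2s≡ = begin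
        at (x + S2 k + S2 k)       ≡⟨ cong at (+-assoc x (S2 k) (S2 k)) ⟩
        at (x + (S2 k + S2 k))     ≡⟨ cong (λ z → at (x + z)) (s+s≡[k∸1]+n 1≤k) ⟩
        at (x + (k ∸ 1 + N k))     ≡⟨ cong at (+-assoc x (k ∸ 1) (N k)) ⟨
        at (x + (k ∸ 1) + N k)     ≡⟨ at-+n (x + (k ∸ 1)) ⟩
        at (x + (k ∸ 1))           ∎
        where open ≡-Reasoning

  walk-v : 1 ≤ k → ∀ r → Walk₀ (v (at r)) (distV k r)
  walk-v 1≤k r = walk-⊓ (walk-⊓ (walk-v-spoke r) (walk-v-inner r)) (walk-v-inner² 1≤k r)

  walk-u : 1 ≤ k → ∀ r → Walk₀ (u (at r)) (distU k r)
  walk-u 1≤k r = walk-⊓ (walk-⊓ (rim-forward r) (+spoke⁻ (walk-v-inner r)))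
                        (+spoke⁻ (walk-v-inner² 1≤k r))

  walk-dist : 1 ≤ k → ∀ y → Walk₀ y (dist y)
  walk-dist 1≤k (u i) with at-radius⊎neg i
  ... | inj₁ e = retype (cong u (sym e)) refl (walk-u 1≤k _)
  ... | inj₂ e = retype (cong u (sym e)) refl (reflect-walk₀ (walk-u 1≤k _))
  walk-dist 1≤k (v i) with at-radius⊎neg i
  ... | inj₁ e = retype (cong v (sym e)) refl (walk-v 1≤k _)
  ... | inj₂ e = retype (cong v (sym e)) refl (reflect-walk₀ (walk-v 1≤k _))

distV≤spoke : ∀ k r → distV k r ≤ suc r
distV≤spoke k r = ≤-trans (m⊓n≤m _ _) (m⊓n≤m _ _)

distV≤inner : ∀ k r → distV k r ≤ 2 + ∣ r - (2 + k) ∣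
distV≤inner k r = ≤-trans (m⊓n≤m _ _) (m⊓n≤n _ _)

distV≤inner² : ∀ k r → distV k r ≤ 3 + ∣ r - (k ∸ 1) ∣
distV≤inner² k r = m⊓n≤n _ _

distU-rim : ∀ k r r' → ∣ r' - r ∣ ≤ 1 → distU k r' ≤ suc (distU k r)
distU-rim k r r' h = ⊓-mono-≤ (⊓-mono-≤ r'≤1+r (+-monoʳ-≤ 3 (moves (2 + k)))) (+-monoʳ-≤ 4 (moves (k ∸ 1)))
  where
    r'≤1+r : r' ≤ suc r
    r'≤1+r = ≤-trans (m≤n+∣m-n∣ r' r) (≤-trans (+-monoʳ-≤ r h) (≤-reflexive (+-comm r 1)))
    moves : ∀ c → ∣ r' - c ∣ ≤ suc ∣ r - c ∣
    moves c = ≤-trans (∣-∣-triangle r' r c) (+-monoˡ-≤ ∣ r - c ∣ h)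

distV-spoke : ∀ k r → distV k r ≤ suc (distU k r)
distV-spoke k r = ⊓-mono-≤ (⊓-mono-≤ ≤-refl (+-monoˡ-≤ ∣ r - (2 + k) ∣ (s≤s (s≤s z≤n))))
                           (+-monoˡ-≤ ∣ r - (k ∸ 1) ∣ (s≤s (s≤s (s≤s z≤n))))

distU-spoke : ∀ k r → distU k r ≤ suc (distV k r)
distU-spoke k r = ⊓-mono-≤ (⊓-mono-≤ (≤-trans (n≤1+n r) (n≤1+n _)) ≤-refl) ≤-refl

distV-inner-sum : ∀ k' a b → a + b ≡ 3 + k' → distV (suc k') b ≤ suc (distV (suc k') a)
distV-inner-sum k' a b e = ≤-⊓₃ ≤spoke ≤inner ≤inner²
  where
    ∣b-[2+k]∣≡a : ∣ b - (3 + k') ∣ ≡ a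
    ∣b-[2+k]∣≡a = trans (cong (λ z → ∣ b - z ∣) (trans (sym e) (+-comm a b))) (∣m-m+n∣≡n b a)
    ∣a-[2+k]∣≡b : ∣ a - (3 + k') ∣ ≡ b
    ∣a-[2+k]∣≡b = trans (cong (λ z → ∣ a - z ∣) (sym e)) (∣m-m+n∣≡n a b)
    b≤3+[k'∸a] : b ≤ 3 + (k' ∸ a)
    b≤3+[k'∸a] = +-cancelʳ-≤ a b (3 + (k' ∸ a)) (subst (_≤ 3 + (k' ∸ a) + a) (sym (trans (+-comm b a) e))
                   (+-monoʳ-≤ 3 (subst (k' ≤_) (+-comm a (k' ∸ a)) (m≤n+m∸n k' a))))
    ≤spoke : distV (suc k') b ≤ suc (suc a)
    ≤spoke = ≤-trans (distV≤inner (suc k') b) (≤-reflexive (cong (λ z → 2 + z) ∣b-[2+k]∣≡a))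
    ≤inner : distV (suc k') b ≤ suc (2 + ∣ a - (3 + k') ∣)
    ≤inner = ≤-trans (distV≤spoke (suc k') b)
                  (subst (λ z → suc b ≤ 3 + z) (sym ∣a-[2+k]∣≡b) (m+n≡o⇒m≤o (+-comm (suc b) 2)))
    ≤inner² : distV (suc k') b ≤ suc (3 + ∣ a - k' ∣)
    ≤inner² = ≤-trans (distV≤spoke (suc k') b) (s≤s (≤-trans b≤3+[k'∸a] (+-monoʳ-≤ 3 (m∸n≤∣n-m∣ k' a))))

distV-inner-desc : ∀ k' b → distV (suc k') b ≤ suc (distV (suc k') (b + (3 + k')))
distV-inner-desc k' b = ≤-⊓₃ ≤spoke ≤inner ≤inner²
  where
    ∣b+[2+k]-[k-1]∣ : ∣ b + (3 + k') - k' ∣ ≡ b + 3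
    ∣b+[2+k]-[k-1]∣ = trans (cong (λ z → ∣ z - k' ∣) (sym (+-assoc b 3 k'))) (∣n+m-m∣≡n k' (b + 3))
    ≤spoke : distV (suc k') b ≤ suc (suc (b + (3 + k')))
    ≤spoke = ≤-trans (distV≤spoke (suc k') b) (s≤s (≤-trans (m≤m+n b (3 + k')) (n≤1+n _)))
    ≤inner : distV (suc k') b ≤ suc (2 + ∣ (b + (3 + k')) - (3 + k') ∣)
    ≤inner = ≤-trans (distV≤spoke (suc k') b)
                  (subst (λ z → suc b ≤ 3 + z) (sym (∣n+m-m∣≡n (3 + k') b)) (m+n≡o⇒m≤o (+-comm (suc b) 2)))
    ≤inner² : distV (suc k') b ≤ suc (3 + ∣ (b + (3 + k')) - k' ∣)
    ≤inner² = ≤-trans (distV≤spoke (suc k') b)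
                   (s≤s (subst (λ z → b ≤ 3 + z) (sym ∣b+[2+k]-[k-1]∣) (≤-trans (m≤m+n b 3) (m≤n+m (b + 3) 3))))

distV-inner-asc : ∀ k' a → (a + (3 + k')) + (a + (3 + k')) ≤ N (suc k') →
                  distV (suc k') (a + (3 + k')) ≤ suc (distV (suc k') a)
distV-inner-asc k' a bound = ≤-⊓₃ ≤spoke ≤inner ≤inner²
  where
    2a≤k' : a + a ≤ k'
    2a≤k' = ≤-certified 0 0 bound (identity a k')
      where identity : ∀ a k' → 1 * k' + ((a + (3 + k')) + (a + (3 + k')))
                                   ≡ 1 * (a + a) + suc (suc (suc (3 * suc k'))) + 0
            identity = solve-∀
    ≤spoke : distV (suc k') (a + (3 + k')) ≤ suc (suc a)
    ≤spoke = ≤-trans (distV≤inner (suc k') (a + (3 + k'))) (≤-reflexive (cong (λ z → 2 + z) (∣n+m-m∣≡n (3 + k') a)))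
    a≤∣a-c∣ : ∀ c → a + a ≤ c → a ≤ ∣ a - c ∣
    a≤∣a-c∣ c 2a≤c = ≤-trans (m+n≤o⇒m≤o∸n a 2a≤c) (m∸n≤∣n-m∣ c a)
    ≤inner : distV (suc k') (a + (3 + k')) ≤ suc (2 + ∣ a - (3 + k') ∣)
    ≤inner = ≤-trans ≤spoke (s≤s (s≤s (≤-trans (a≤∣a-c∣ (3 + k') (≤-trans 2a≤k' (m≤n+m k' 3))) (n≤1+n _))))
    ≤inner² : distV (suc k') (a + (3 + k')) ≤ suc (3 + ∣ a - k' ∣)
    ≤inner² = ≤-trans ≤spoke (s≤s (s≤s (≤-trans (a≤∣a-c∣ k' 2a≤k') (≤-trans (n≤1+n _) (n≤1+n _)))))

distV-inner-wrap : ∀ k' a b → a + b + (3 + k') ≡ N (suc k') → b + b ≤ N (suc k') →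
                   distV (suc k') b ≤ suc (distV (suc k') a)
distV-inner-wrap k' a b around bound = ≤-⊓₃ ≤spoke ≤inner ≤inner²
  where
    e : a + b ≡ S2 (suc k')
    e = +-cancelʳ-≡ (3 + k') _ _ (trans around (identity k'))
      where identity : ∀ k' → suc (suc (suc (3 * suc k'))) ≡ suc (2 * suc k') + (3 + k')
            identity = solve-∀
    k'≤2a : k' ≤ a + a
    k'≤2a = ≤-certified 0 0 bound (trans (regroup a b) (trans (cong₂ _+_ e e) (identity k')))
      where regroup : ∀ a b → 1 * (a + a) + (b + b) ≡ (a + b) + (a + b)
            regroup = solve-∀
            identity : ∀ k' → suc (2 * suc k') + suc (2 * suc k') ≡ 1 * k' + suc (suc (suc (3 * suc k'))) + 0
            identity = solve-∀
    ∣a-[k-1]∣≤a : ∣ a - k' ∣ ≤ a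
    ∣a-[k-1]∣≤a with ∣m-n∣≡[m∸n]∨[n∸m] a k'
    ... | inj₁ q = subst (_≤ a) (sym q) (m∸n≤m a k')
    ... | inj₂ q = subst (_≤ a) (sym q) (≤-trans (∸-monoˡ-≤ a k'≤2a) (≤-reflexive (m+n∸n≡m a a)))
    ∣b-[2+k]∣ : ∣ b - (3 + k') ∣ ≡ ∣ a - k' ∣
    ∣b-[2+k]∣ = ∣-∣-exchange a b (3 + k') k' (trans e (identity k'))
      where identity : ∀ k' → suc (2 * suc k') ≡ 3 + k' + k'
            identity = solve-∀
    ∣b-[k-1]∣ : ∣ b - k' ∣ ≡ ∣ a - (3 + k') ∣
    ∣b-[k-1]∣ = ∣-∣-exchange a b k' (3 + k') (trans e (identity k'))
      where identity : ∀ k' → suc (2 * suc k') ≡ k' + (3 + k')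
            identity = solve-∀
    ≤inner-b : distV (suc k') b ≤ 2 + ∣ a - k' ∣
    ≤inner-b = ≤-trans (distV≤inner (suc k') b) (≤-reflexive (cong (λ z → 2 + z) ∣b-[2+k]∣))
    ≤spoke : distV (suc k') b ≤ suc (suc a)
    ≤spoke = ≤-trans ≤inner-b (+-monoʳ-≤ 2 ∣a-[k-1]∣≤a)
    ≤inner : distV (suc k') b ≤ suc (2 + ∣ a - (3 + k') ∣)
    ≤inner = ≤-trans (distV≤inner² (suc k') b) (≤-reflexive (cong (λ z → 3 + z) ∣b-[k-1]∣))
    ≤inner² : distV (suc k') b ≤ suc (3 + ∣ a - k' ∣)
    ≤inner² = ≤-trans ≤inner-b (≤-trans (n≤1+n _) (n≤1+n _))

distV-inner : ∀ {k a b} → 1 ≤ k → GeneralisedPetersen.Offset (N k) (S2 k) (2 + k) a b → a + a ≤ N k → b + b ≤ N k →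
              distV k b ≤ suc (distV k a)
distV-inner {suc k'} {a} {b} _ (inj₁ e) _ _ = distV-inner-sum k' a b e
distV-inner {suc k'} _ (inj₂ (inj₁ refl)) _ _ = distV-inner-desc k' _
distV-inner {suc k'} _ (inj₂ (inj₂ (inj₁ refl))) _ bound = distV-inner-asc k' _ bound
distV-inner {suc k'} {a} {b} _ (inj₂ (inj₂ (inj₂ e))) _ bound = distV-inner-wrap k' a b e bound

module Distance (k : ℕ) (1≤k : 1 ≤ k) where
  open Graph k

  -- the inner edge v_t v_{t + s} joins t and t - (k + 2), as s + (k + 2) = n
  radius-inner : ∀ t → t < N k → Offset (2 + k) (radius t) (radius ((t + S2 k) % N k))
  radius-inner t t<n = subst (λ m → Offset (2 + k) (radius t) (radius ((t + m) % N k))) n∸[2+k]≡s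
                         (radius-offset (2 + k) t 2[2+k]≤n t<n)
    where
      n∸[2+k]≡s : N k ∸ (2 + k) ≡ S2 k
      n∸[2+k]≡s = trans (cong (_∸ (2 + k)) (sym s+[2+k]≡n)) (m+n∸n≡m (S2 k) (2 + k))
      2[2+k]≤n : (2 + k) + (2 + k) ≤ N k
      2[2+k]≤n = ≤-certified 0 0 1≤k (identity k)
        where identity : ∀ k → 1 * suc (suc (suc (3 * k))) + 1 ≡ 1 * ((2 + k) + (2 + k)) + k + 0
              identity = solve-∀

  dist-edge : ∀ {y z} → Adj (N k) (S2 k) y z → dist z ≤ suc (dist y)
  dist-edge {u i} {u _} (inj₁ refl) =
    subst (λ z → distU k (radius z) ≤ suc (dist (u i))) (sym (toℕ-at (toℕ i + 1)))
      (distU-rim k _ _ (radius-suc (toℕ i) (FP.toℕ<n i)))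
  dist-edge {u _} {u j} (inj₂ refl) =
    subst (λ z → dist (u j) ≤ suc (distU k (radius z))) (sym (toℕ-at (toℕ j + 1)))
      (distU-rim k _ _ (subst (_≤ 1) (∣-∣-comm (radius ((toℕ j + 1) % N k)) _) (radius-suc (toℕ j) (FP.toℕ<n j))))
  dist-edge {v i} {v _} (inj₁ refl) =
    subst (λ z → distV k (radius z) ≤ suc (dist (v i))) (sym (toℕ-at (toℕ i + S2 k)))
      (distV-inner 1≤k (radius-inner (toℕ i) (FP.toℕ<n i))
                       (radius-half _ (<⇒≤ (FP.toℕ<n i))) (radius-half _ (m%n≤n (toℕ i + S2 k) (N k))))
  dist-edge {v _} {v j} (inj₂ refl) =
    subst (λ z → dist (v j) ≤ suc (distV k (radius z))) (sym (toℕ-at (toℕ j + S2 k)))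
      (distV-inner 1≤k (Offset-sym (radius-inner (toℕ j) (FP.toℕ<n j)))
                       (radius-half _ (m%n≤n (toℕ j + S2 k) (N k))) (radius-half _ (<⇒≤ (FP.toℕ<n j))))
  dist-edge {u i} {v _} refl = distV-spoke k _
  dist-edge {v i} {u _} refl = distU-spoke k _

  dist≤length : ∀ {y m} → Walk₀ y m → dist y ≤ m
  dist≤length nil = z≤n
  dist≤length (step w e) = ≤-trans (dist-edge e) (s≤s (dist≤length w))

  inSphere⇒dist : ∀ d y → InSphere (N k) (S2 k) (u (at 0)) d y → dist y ≡ d
  inSphere⇒dist d y (w , shortest) with dist y <? d
  ... | yes lt = ⊥-elim (shortest (dist y) lt (walk-dist 1≤k y))
  ... | no nlt = ≤-antisym (dist≤length w) (≮⇒≥ nlt)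

  dist⇒inSphere : ∀ d y → dist y ≡ d → InSphere (N k) (S2 k) (u (at 0)) d y
  dist⇒inSphere d y refl = walk-dist 1≤k y , λ j j<d w → <⇒≱ j<d (dist≤length w)

data Position (k r : ℕ) : Set where
  below  : ∀ e → k ≡ suc (r + e) → Position k r
  at-k   : r ≡ k → Position k r
  at-k+1 : r ≡ suc k → Position k r
  above  : ∀ e → r ≡ 2 + k + e → Position k r

position : ∀ k r → Position k r
position k r with <-cmp r k
... | tri< r<k _ _ = below (k ∸ suc r) (sym (m+[n∸m]≡n r<k))
... | tri≈ _ r≡k _ = at-k r≡k
... | tri> _ _ k<r with m≤n⇒m<n∨m≡n k<r
...   | inj₁ 1+k<r = above (r ∸ (2 + k)) (sym (m+[n∸m]≡n 1+k<r))
...   | inj₂ 1+k≡r = at-k+1 (sym 1+k≡r)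

distU-below : ∀ r e → distU (suc (r + e)) r ≡ r ⊓ (4 + e)
distU-below r e = begin
  (r ⊓ (3 + ∣ r - (2 + suc (r + e)) ∣)) ⊓ (4 + ∣ r - (r + e) ∣)
    ≡⟨ cong₂ (λ a b → (r ⊓ (3 + a)) ⊓ (4 + b)) (trans (cong (λ z → ∣ r - z ∣) (shape r e)) (∣m-m+n∣≡n r (3 + e))) (∣m-m+n∣≡n r e) ⟩
  (r ⊓ (6 + e)) ⊓ (4 + e)    ≡⟨ ⊓-assoc r (6 + e) (4 + e) ⟩
  r ⊓ ((6 + e) ⊓ (4 + e))    ≡⟨ cong (r ⊓_) (m≥n⇒m⊓n≡n (m≤n+m (4 + e) 2)) ⟩
  r ⊓ (4 + e)                ∎
  where
    open ≡-Reasoning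
    shape : ∀ r e → 2 + suc (r + e) ≡ r + (3 + e)
    shape = solve-∀

distV-below : ∀ r e → distV (suc (r + e)) r ≡ suc r ⊓ (3 + e)
distV-below r e = begin
  (suc r ⊓ (2 + ∣ r - (2 + suc (r + e)) ∣)) ⊓ (3 + ∣ r - (r + e) ∣)
    ≡⟨ cong₂ (λ a b → (suc r ⊓ (2 + a)) ⊓ (3 + b)) (trans (cong (λ z → ∣ r - z ∣) (shape r e)) (∣m-m+n∣≡n r (3 + e))) (∣m-m+n∣≡n r e) ⟩
  (suc r ⊓ (5 + e)) ⊓ (3 + e)    ≡⟨ ⊓-assoc (suc r) (5 + e) (3 + e) ⟩
  suc r ⊓ ((5 + e) ⊓ (3 + e))    ≡⟨ cong (suc r ⊓_) (m≥n⇒m⊓n≡n (m≤n+m (3 + e) 2)) ⟩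
  suc r ⊓ (3 + e)                ∎
  where
    open ≡-Reasoning
    shape : ∀ r e → 2 + suc (r + e) ≡ r + (3 + e)
    shape = solve-∀

distU-at-k : ∀ {k} → 5 ≤ k → distU k k ≡ 5
distU-at-k {k} (s≤s (s≤s (s≤s (s≤s (s≤s {n = j} _))))) = begin
  (k ⊓ (3 + ∣ k - (2 + k) ∣)) ⊓ (4 + ∣ k - (4 + j) ∣)
    ≡⟨ cong₂ (λ a b → (k ⊓ (3 + a)) ⊓ (4 + b)) (∣m-[n+m]∣≡n k 2) (∣n+m-m∣≡n j 1) ⟩
  (k ⊓ 5) ⊓ 5    ≡⟨ cong (_⊓ 5) (m≥n⇒m⊓n≡n (m≤m+n 5 j)) ⟩
  5              ∎
  where open ≡-Reasoning

distU-at-k+1 : ∀ {k} → 3 ≤ k → distU k (suc k) ≡ 4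
distU-at-k+1 {k} (s≤s (s≤s (s≤s {n = j} _))) = begin
  (suc k ⊓ (3 + ∣ suc k - (2 + k) ∣)) ⊓ (4 + ∣ suc k - (2 + j) ∣)
    ≡⟨ cong₂ (λ a b → (suc k ⊓ (3 + a)) ⊓ (4 + b)) (∣m-[n+m]∣≡n k 1) (∣n+m-m∣≡n j 2) ⟩
  (suc k ⊓ 4) ⊓ 6    ≡⟨ cong (_⊓ 6) (m≥n⇒m⊓n≡n (m≤m+n 4 j)) ⟩
  4                  ∎
  where open ≡-Reasoning

distV-at-k : ∀ {k} → 3 ≤ k → distV k k ≡ 4
distV-at-k {k} (s≤s (s≤s (s≤s {n = j} _))) = begin
  (suc k ⊓ (2 + ∣ k - (2 + k) ∣)) ⊓ (3 + ∣ k - (2 + j) ∣)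
    ≡⟨ cong₂ (λ a b → (suc k ⊓ (2 + a)) ⊓ (3 + b)) (∣m-[n+m]∣≡n k 2) (∣n+m-m∣≡n j 1) ⟩
  (suc k ⊓ 4) ⊓ 4    ≡⟨ cong (_⊓ 4) (m≥n⇒m⊓n≡n (m≤m+n 4 j)) ⟩
  4                  ∎
  where open ≡-Reasoning

distV-at-k+1 : ∀ {k} → 1 ≤ k → distV k (suc k) ≡ 3
distV-at-k+1 {k} (s≤s {n = j} _) = begin
  (suc (suc k) ⊓ (2 + ∣ suc k - (2 + k) ∣)) ⊓ (3 + ∣ suc k - j ∣)
    ≡⟨ cong₂ (λ a b → (suc (suc k) ⊓ (2 + a)) ⊓ (3 + b)) (∣m-[n+m]∣≡n k 1) (∣n+m-m∣≡n j 2) ⟩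
  (suc (suc k) ⊓ 3) ⊓ 5    ≡⟨ cong (_⊓ 5) (m≥n⇒m⊓n≡n (m≤m+n 3 j)) ⟩
  3                        ∎
  where open ≡-Reasoning

distU-above : ∀ {k} → 1 ≤ k → ∀ e → distU k (2 + k + e) ≡ 3 + e
distU-above {k} (s≤s {n = j} _) e = begin
  ((2 + k + e) ⊓ (3 + ∣ 2 + k + e - (2 + k) ∣)) ⊓ (4 + ∣ 2 + k + e - j ∣)
    ≡⟨ cong₂ (λ a b → ((2 + k + e) ⊓ (3 + a)) ⊓ (4 + b)) (∣m+n-m∣≡n (2 + k) e)
             (trans (cong (λ z → ∣ z - j ∣) (shape j e)) (∣n+m-m∣≡n j (3 + e))) ⟩
  ((2 + k + e) ⊓ (3 + e)) ⊓ (7 + e)  ≡⟨ cong (_⊓ (7 + e)) (m≥n⇒m⊓n≡n (m+n≡o⇒m≤o (reorder j e))) ⟩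
  (3 + e) ⊓ (7 + e)                  ≡⟨ m≤n⇒m⊓n≡m (m≤n+m (3 + e) 4) ⟩
  3 + e                              ∎
  where
    open ≡-Reasoning
    shape : ∀ j e → 3 + j + e ≡ 3 + e + j
    shape = solve-∀
    reorder : ∀ j e → 3 + e + j ≡ 3 + j + e
    reorder = solve-∀

distV-above : ∀ {k} → 1 ≤ k → ∀ e → distV k (2 + k + e) ≡ 2 + e
distV-above {k} (s≤s {n = j} _) e = begin
  (suc (2 + k + e) ⊓ (2 + ∣ 2 + k + e - (2 + k) ∣)) ⊓ (3 + ∣ 2 + k + e - j ∣)
    ≡⟨ cong₂ (λ a b → (suc (2 + k + e) ⊓ (2 + a)) ⊓ (3 + b)) (∣m+n-m∣≡n (2 + k) e)
             (trans (cong (λ z → ∣ z - j ∣) (shape j e)) (∣n+m-m∣≡n j (3 + e))) ⟩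
  (suc (2 + k + e) ⊓ (2 + e)) ⊓ (6 + e)  ≡⟨ cong (_⊓ (6 + e)) (m≥n⇒m⊓n≡n (m+n≡o⇒m≤o (reorder j e))) ⟩
  (2 + e) ⊓ (6 + e)                      ≡⟨ m≤n⇒m⊓n≡m (m≤n+m (2 + e) 4) ⟩
  2 + e                                  ∎
  where
    open ≡-Reasoning
    shape : ∀ j e → 3 + j + e ≡ 3 + e + j
    shape = solve-∀
    reorder : ∀ j e → 2 + e + (2 + j) ≡ 4 + j + e
    reorder = solve-∀

-- the radii r ≤ n/2 with distU k r ≡ d, classified by the route of a shortest walk to u_r
data LevelU (k r d : ℕ) : Set where
  by-rim    : r ≡ d → d + d ≤ k + 3 → LevelU k r d
  by-inner² : r + d ≡ k + 3 → d + d ≤ k + 3 → 4 ≤ d → LevelU k r d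
  at-k      : r ≡ k → d ≡ 5 → LevelU k r d
  at-k+1    : r ≡ suc k → d ≡ 4 → LevelU k r d
  by-inner  : r + 1 ≡ k + d → 3 ≤ d → d + d ≤ k + 5 → LevelU k r d

data LevelV (k r d : ℕ) : Set where
  by-rim    : suc r ≡ d → d + d ≤ k + 3 → LevelV k r d
  by-inner² : r + d ≡ k + 2 → d + d ≤ k + 3 → 3 ≤ d → LevelV k r d
  at-k      : r ≡ k → d ≡ 4 → LevelV k r d
  at-k+1    : r ≡ suc k → d ≡ 3 → LevelV k r d
  by-inner  : r ≡ k + d → 2 ≤ d → d + d ≤ k + 3 → LevelV k r d

5≤k⇒1≤k : ∀ {k} → 5 ≤ k → 1 ≤ k
5≤k⇒1≤k = ≤-trans (s≤s z≤n)

5≤k⇒3≤k : ∀ {k} → 5 ≤ k → 3 ≤ k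
5≤k⇒3≤k = ≤-trans (s≤s (s≤s (s≤s z≤n)))

distU≡⇒LevelU : ∀ {k r d} → 5 ≤ k → r + r ≤ N k → distU k r ≡ d → LevelU k r d
distU≡⇒LevelU {k} {r} 5≤k half refl with position k r
... | below e refl with ≤-total r (4 + e)
...   | inj₁ le = subst (LevelU k r) (trans (sym (m≤n⇒m⊓n≡m le)) (sym (distU-below r e)))
                    (by-rim refl (≤-certified 0 0 le (identity r e)))
  where identity : ∀ r e → 1 * (suc (r + e) + 3) + r ≡ 1 * (r + r) + (4 + e) + 0
        identity = solve-∀
...   | inj₂ ge = subst (LevelU k r) (trans (sym (m≥n⇒m⊓n≡n ge)) (sym (distU-below r e)))
                    (by-inner² (identity₁ r e) (≤-certified 0 0 ge (identity₂ r e)) (m≤m+n 4 e))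
  where identity₁ : ∀ r e → r + (4 + e) ≡ suc (r + e) + 3
        identity₁ = solve-∀
        identity₂ : ∀ r e → 1 * (suc (r + e) + 3) + (4 + e) ≡ 1 * ((4 + e) + (4 + e)) + r + 0
        identity₂ = solve-∀
distU≡⇒LevelU {k} 5≤k half refl | at-k refl = at-k refl (distU-at-k 5≤k)
distU≡⇒LevelU {k} 5≤k half refl | at-k+1 refl = at-k+1 refl (distU-at-k+1 (5≤k⇒3≤k 5≤k))
distU≡⇒LevelU {k} 5≤k half refl | above e refl =
  subst (LevelU k (2 + k + e)) (sym (distU-above (5≤k⇒1≤k 5≤k) e))
    (by-inner (identity₁ k e) (m≤m+n 3 e) (≤-certified 0 0 half (identity₂ k e)))
  where identity₁ : ∀ k e → 2 + k + e + 1 ≡ k + (3 + e)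
        identity₁ = solve-∀
        identity₂ : ∀ k e → 1 * (k + 5) + ((2 + k + e) + (2 + k + e)) ≡ 1 * ((3 + e) + (3 + e)) + suc (suc (suc (3 * k))) + 0
        identity₂ = solve-∀

LevelU⇒distU≡ : ∀ {k r d} → 5 ≤ k → LevelU k r d → distU k r ≡ d
LevelU⇒distU≡ {k} {r} 5≤k (by-rim refl 2r≤k+3) with m≤n⇒∃[o]m+o≡n r<k
  where
    r<k : suc r ≤ k
    r<k = ≤-certified 1 0 (+-mono-≤ 2r≤k+3 5≤k) (identity r k)
      where identity : ∀ r k → 2 * k + (r + r + 5) ≡ 2 * suc r + (k + 3 + k) + 0
            identity = solve-∀
... | e , refl = trans (distU-below r e) (m≤n⇒m⊓n≡m (≤-certified 0 0 2r≤k+3 (identity r e)))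
  where identity : ∀ r e → 1 * (4 + e) + (r + r) ≡ 1 * r + (suc (r + e) + 3) + 0
        identity = solve-∀
LevelU⇒distU≡ {k} {r} 5≤k (by-inner² r+d≡k+3 2d≤k+3 4≤d) with m≤n⇒∃[o]m+o≡n 4≤d
... | e , refl with +-cancelʳ-≡ 3 k (suc (r + e)) (trans (sym r+d≡k+3) (identity r e))
  where identity : ∀ r e → r + (4 + e) ≡ suc (r + e) + 3
        identity = solve-∀
...   | refl = trans (distU-below r e) (m≥n⇒m⊓n≡n (≤-certified 0 0 2d≤k+3 (identity r e)))
  where identity : ∀ r e → 1 * r + ((4 + e) + (4 + e)) ≡ 1 * (4 + e) + (suc (r + e) + 3) + 0
        identity = solve-∀
LevelU⇒distU≡ 5≤k (at-k refl refl) = distU-at-k 5≤k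
LevelU⇒distU≡ 5≤k (at-k+1 refl refl) = distU-at-k+1 (5≤k⇒3≤k 5≤k)
LevelU⇒distU≡ {k} {r} 5≤k (by-inner r+1≡k+d 3≤d _) with m≤n⇒∃[o]m+o≡n 3≤d
... | e , refl with +-cancelʳ-≡ 1 r (2 + k + e) (trans r+1≡k+d (identity k e))
  where identity : ∀ k e → k + (3 + e) ≡ 2 + k + e + 1
        identity = solve-∀
...   | refl = distU-above (5≤k⇒1≤k 5≤k) e

distV≡⇒LevelV : ∀ {k r d} → 5 ≤ k → r + r ≤ N k → distV k r ≡ d → LevelV k r d
distV≡⇒LevelV {k} {r} 5≤k half refl with position k r
... | below e refl with ≤-total (suc r) (3 + e)
...   | inj₁ le = subst (LevelV k r) (trans (sym (m≤n⇒m⊓n≡m le)) (sym (distV-below r e)))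
                    (by-rim refl (≤-certified 0 0 le (identity r e)))
  where identity : ∀ r e → 1 * (suc (r + e) + 3) + suc r ≡ 1 * (suc r + suc r) + (3 + e) + 0
        identity = solve-∀
...   | inj₂ ge = subst (LevelV k r) (trans (sym (m≥n⇒m⊓n≡n ge)) (sym (distV-below r e)))
                    (by-inner² (identity₁ r e) (≤-certified 0 0 ge (identity₂ r e)) (m≤m+n 3 e))
  where identity₁ : ∀ r e → r + (3 + e) ≡ suc (r + e) + 2
        identity₁ = solve-∀
        identity₂ : ∀ r e → 1 * (suc (r + e) + 3) + (3 + e) ≡ 1 * ((3 + e) + (3 + e)) + suc r + 0
        identity₂ = solve-∀
distV≡⇒LevelV {k} 5≤k half refl | at-k refl = at-k refl (distV-at-k (5≤k⇒3≤k 5≤k))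
distV≡⇒LevelV {k} 5≤k half refl | at-k+1 refl = at-k+1 refl (distV-at-k+1 (5≤k⇒1≤k 5≤k))
distV≡⇒LevelV {k} 5≤k half refl | above e refl =
  subst (LevelV k (2 + k + e)) (sym (distV-above (5≤k⇒1≤k 5≤k) e))
    (by-inner (identity₁ k e) (m≤m+n 2 e) (≤-certified 0 0 half (identity₂ k e)))
  where identity₁ : ∀ k e → 2 + k + e ≡ k + (2 + e)
        identity₁ = solve-∀
        identity₂ : ∀ k e → 1 * (k + 3) + ((2 + k + e) + (2 + k + e)) ≡ 1 * ((2 + e) + (2 + e)) + suc (suc (suc (3 * k))) + 0
        identity₂ = solve-∀

LevelV⇒distV≡ : ∀ {k r d} → 5 ≤ k → LevelV k r d → distV k r ≡ d
LevelV⇒distV≡ {k} {r} 5≤k (by-rim refl 2d≤k+3) with m≤n⇒∃[o]m+o≡n r<k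
  where
    r<k : suc r ≤ k
    r<k = ≤-certified 1 2 (+-mono-≤ 2d≤k+3 5≤k) (identity r k)
      where identity : ∀ r k → 2 * k + (suc r + suc r + 5) ≡ 2 * suc r + (k + 3 + k) + 2
            identity = solve-∀
... | e , refl = trans (distV-below r e) (m≤n⇒m⊓n≡m (≤-certified 0 0 2d≤k+3 (identity r e)))
  where identity : ∀ r e → 1 * (3 + e) + (suc r + suc r) ≡ 1 * suc r + (suc (r + e) + 3) + 0
        identity = solve-∀
LevelV⇒distV≡ {k} {r} 5≤k (by-inner² r+d≡k+2 2d≤k+3 3≤d) with m≤n⇒∃[o]m+o≡n 3≤d
... | e , refl with +-cancelʳ-≡ 2 k (suc (r + e)) (trans (sym r+d≡k+2) (identity r e))
  where identity : ∀ r e → r + (3 + e) ≡ suc (r + e) + 2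
        identity = solve-∀
...   | refl = trans (distV-below r e) (m≥n⇒m⊓n≡n (≤-certified 0 0 2d≤k+3 (identity r e)))
  where identity : ∀ r e → 1 * suc r + ((3 + e) + (3 + e)) ≡ 1 * (3 + e) + (suc (r + e) + 3) + 0
        identity = solve-∀
LevelV⇒distV≡ 5≤k (at-k refl refl) = distV-at-k (5≤k⇒3≤k 5≤k)
LevelV⇒distV≡ 5≤k (at-k+1 refl refl) = distV-at-k+1 (5≤k⇒1≤k 5≤k)
LevelV⇒distV≡ {k} 5≤k (by-inner refl 2≤d _) with m≤n⇒∃[o]m+o≡n 2≤d
... | e , refl = trans (cong (distV k) (identity k e)) (distV-above (5≤k⇒1≤k 5≤k) e)
  where identity : ∀ k e → k + (2 + e) ≡ 2 + k + e
        identity = solve-∀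

LevelU-bound : ∀ {k r d} → 5 ≤ k → LevelU k r d → d + d ≤ k + 5
LevelU-bound {k} _ (by-rim _ 2d≤k+3) = ≤-trans 2d≤k+3 (+-monoʳ-≤ k (m≤m+n 3 2))
LevelU-bound {k} _ (by-inner² _ 2d≤k+3 _) = ≤-trans 2d≤k+3 (+-monoʳ-≤ k (m≤m+n 3 2))
LevelU-bound 5≤k (at-k _ refl) = +-monoˡ-≤ 5 5≤k
LevelU-bound 5≤k (at-k+1 _ refl) = ≤-trans (m≤m+n 8 2) (+-monoˡ-≤ 5 5≤k)
LevelU-bound _ (by-inner _ _ 2d≤k+5) = 2d≤k+5

LevelV-bound : ∀ {k r d} → 5 ≤ k → LevelV k r d → d + d ≤ k + 3
LevelV-bound _ (by-rim _ 2d≤k+3) = 2d≤k+3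
LevelV-bound _ (by-inner² _ 2d≤k+3 _) = 2d≤k+3
LevelV-bound 5≤k (at-k _ refl) = +-monoˡ-≤ 3 5≤k
LevelV-bound 5≤k (at-k+1 _ refl) = ≤-trans (m≤m+n 6 2) (+-monoˡ-≤ 3 5≤k)
LevelV-bound _ (by-inner _ _ 2d≤k+3) = 2d≤k+3

data Side : Set where
  outer inner : Side

vertex : ∀ {n} → Side → Fin n → Vtx n
vertex outer = u
vertex inner = v

vertex-injective : ∀ {n σ σ'} {i j : Fin n} → vertex σ i ≡ vertex σ' j → σ ≡ σ' × i ≡ j
vertex-injective {σ = outer} {outer} refl = refl , refl
vertex-injective {σ = inner} {inner} refl = refl , refl

onSide : Side → Side → ℕ → List ℕ → List ℕ
onSide outer outer r rs = r ∷ rs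
onSide inner inner r rs = r ∷ rs
onSide outer inner r rs = rs
onSide inner outer r rs = rs

onSide-here : ∀ σ {r rs} → r ∈ onSide σ σ r rs
onSide-here outer = here refl
onSide-here inner = here refl

onSide-there : ∀ σ σ' {x r rs} → x ∈ rs → x ∈ onSide σ σ' r rs
onSide-there outer outer m = there m
onSide-there inner inner m = there m
onSide-there outer inner m = m
onSide-there inner outer m = m

onSide⁻ : ∀ σ σ' {x r rs} → x ∈ onSide σ σ' r rs → (σ ≡ σ' × x ≡ r) ⊎ x ∈ rs
onSide⁻ outer outer (here e) = inj₁ (refl , e)
onSide⁻ inner inner (here e) = inj₁ (refl , e)
onSide⁻ outer outer (there m) = inj₂ m
onSide⁻ inner inner (there m) = inj₂ m
onSide⁻ outer inner m = inj₂ m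
onSide⁻ inner outer m = inj₂ m

module Blocks (k : ℕ) where
  open Graph k

  data Block : Set where
    pair   : Side → ℤ → Block
    single : Side → (z : ℤ) → neg (ix (N k) z) ≡ ix (N k) z → Block

  vertices : List Block → List (Vtx (N k))
  vertices [] = []
  vertices (pair σ z ∷ bs) = vertex σ (ix (N k) z) ∷ vertex σ (ix (N k) (ℤ.- z)) ∷ vertices bs
  vertices (single σ z _ ∷ bs) = vertex σ (ix (N k) z) ∷ vertices bs

  radii : Side → List Block → List ℕ
  radii σ [] = []
  radii σ (pair σ' z ∷ bs) = onSide σ σ' (radius (z %ℕ N k)) (radii σ bs)
  radii σ (single σ' z _ ∷ bs) = onSide σ σ' (radius (z %ℕ N k)) (radii σ bs)

  radius-ix : ∀ z → radius (toℕ (ix (N k) z)) ≡ radius (z %ℕ N k)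
  radius-ix z = cong radius (FP.toℕ-fromℕ< (n%ℕd<d z (N k)))

  radius-ix-neg : ∀ z → radius (toℕ (ix (N k) (ℤ.- z))) ≡ radius (z %ℕ N k)
  radius-ix-neg z = trans (cong (radius ∘ toℕ) (ix-neg z)) (trans (radius-neg _) (radius-ix z))

  ∈-vertices⁻ : ∀ σ i bs → vertex σ i ∈ vertices bs → radius (toℕ i) ∈ radii σ bs
  ∈-vertices⁻ σ i (pair σ' z ∷ bs) (here e) with vertex-injective e
  ... | refl , refl = subst (_∈ onSide σ σ (radius (z %ℕ N k)) (radii σ bs)) (sym (radius-ix z)) (onSide-here σ)
  ∈-vertices⁻ σ i (pair σ' z ∷ bs) (there (here e)) with vertex-injective e
  ... | refl , refl = subst (_∈ onSide σ σ (radius (z %ℕ N k)) (radii σ bs)) (sym (radius-ix-neg z)) (onSide-here σ)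
  ∈-vertices⁻ σ i (pair σ' z ∷ bs) (there (there m)) = onSide-there σ σ' (∈-vertices⁻ σ i bs m)
  ∈-vertices⁻ σ i (single σ' z _ ∷ bs) (here e) with vertex-injective e
  ... | refl , refl = subst (_∈ onSide σ σ (radius (z %ℕ N k)) (radii σ bs)) (sym (radius-ix z)) (onSide-here σ)
  ∈-vertices⁻ σ i (single σ' z _ ∷ bs) (there m) = onSide-there σ σ' (∈-vertices⁻ σ i bs m)

  ∈-vertices⁺ : ∀ σ i bs → radius (toℕ i) ∈ radii σ bs → vertex σ i ∈ vertices bs
  ∈-vertices⁺ σ i (pair σ' z ∷ bs) m with onSide⁻ σ σ' m
  ... | inj₂ m' = there (there (∈-vertices⁺ σ i bs m'))
  ... | inj₁ (refl , e) with radius-injective i (ix (N k) z) (trans e (sym (radius-ix z)))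
  ...   | inj₁ refl = here refl
  ...   | inj₂ i≡-z = there (here (cong (vertex σ) (trans i≡-z (sym (ix-neg z)))))
  ∈-vertices⁺ σ i (single σ' z self-opposite ∷ bs) m with onSide⁻ σ σ' m
  ... | inj₂ m' = there (∈-vertices⁺ σ i bs m')
  ... | inj₁ (refl , e) with radius-injective i (ix (N k) z) (trans e (sym (radius-ix z)))
  ...   | inj₁ refl = here refl
  ...   | inj₂ i≡-z = here (cong (vertex σ) (trans i≡-z self-opposite))

module Spheres (k : ℕ) (5≤k : 5 ≤ k) where
  open Graph k public
  open Blocks k public
  open Distance k (5≤k⇒1≤k 5≤k)

  distOn : Side → ℕ → ℕ
  distOn outer = distU k
  distOn inner = distV k

  dist-vertex : ∀ σ i → dist (vertex σ i) ≡ distOn σ (radius (toℕ i))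
  dist-vertex outer i = refl
  dist-vertex inner i = refl

  module _ (d : ℕ) (bs : List Block)
           (complete : ∀ σ r → r + r ≤ N k → distOn σ r ≡ d → r ∈ radii σ bs)
           (sound : ∀ σ r → r ∈ radii σ bs → distOn σ r ≡ d) where

    sphere-at : ∀ σ i → (InSphere (N k) (S2 k) (u (at 0)) d (vertex σ i) → vertex σ i ∈ vertices bs)
                      × (vertex σ i ∈ vertices bs → InSphere (N k) (S2 k) (u (at 0)) d (vertex σ i))
    sphere-at σ i =
      (λ y∈S → ∈-vertices⁺ σ i bs (complete σ _ (radius-half _ (<⇒≤ (FP.toℕ<n i)))
                                     (trans (sym (dist-vertex σ i)) (inSphere⇒dist d _ y∈S)))) ,
      (λ y∈L → dist⇒inSphere d _ (trans (dist-vertex σ i) (sound σ _ (∈-vertices⁻ σ i bs y∈L))))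

    sphere-by-radii : Sph k d (vertices bs)
    sphere-by-radii (u i) = sphere-at outer i
    sphere-by-radii (v i) = sphere-at inner i

  sphere-by-levels : ∀ d bs {us vs} → radii outer bs ≡ us → radii inner bs ≡ vs →
                     (∀ r → r + r ≤ N k → LevelU k r d → r ∈ us) → (∀ r → r ∈ us → LevelU k r d) →
                     (∀ r → r + r ≤ N k → LevelV k r d → r ∈ vs) → (∀ r → r ∈ vs → LevelV k r d) →
                     Sph k d (vertices bs)
  sphere-by-levels d bs refl refl completeU soundU completeV soundV = sphere-by-radii d bs complete sound
    where
      complete : ∀ σ r → r + r ≤ N k → distOn σ r ≡ d → r ∈ radii σ bs
      complete outer r half e = completeU r half (distU≡⇒LevelU 5≤k half e)
      complete inner r half e = completeV r half (distV≡⇒LevelV 5≤k half e)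
      sound : ∀ σ r → r ∈ radii σ bs → distOn σ r ≡ d
      sound outer r m = LevelU⇒distU≡ 5≤k (soundU r m)
      sound inner r m = LevelV⇒distV≡ 5≤k (soundV r m)

  radius-%-by : ∀ a w → a + a + w ≡ N k → radius (a % N k) ≡ a
  radius-%-by a w e = radius-% a (m+n≡o⇒m≤o e)

  sphere-beyond : ∀ d → k + 5 < d + d → Sph k d []
  sphere-beyond d far = sphere-by-levels d [] refl refl
                          (λ _ _ l → ⊥-elim (<⇒≱ far (LevelU-bound 5≤k l))) (λ _ ())
                          (λ _ _ l → ⊥-elim (<⇒≱ far (≤-trans (LevelV-bound 5≤k l) (+-monoʳ-≤ k (m≤m+n 3 2))))) (λ _ ())

5≤13+j : ∀ j → 5 ≤ 13 + j
5≤13+j j = m≤n⇒m≤n+o j (s≤s (s≤s (s≤s (s≤s (s≤s z≤n)))))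

Sphere₁ Sphere₂ Sphere₃ Sphere₄ Sphere₅ : ℕ → Set
Sphere₁ k = Sph k 1 (U± k (+ 1) ++ V k (+ 0) ∷ [])
Sphere₂ k = Sph k 2 (U± k (+ 2) ++ V± k (+ 1) ++ V± k (+ k ℤ.+ + 2))
Sphere₃ k = Sph k 3 (U± k (+ 3) ++ U± k (+ k ℤ.+ + 2) ++ V± k (+ 2) ++ V± k (+ k ℤ.+ + 1)
                     ++ V± k (+ k ℤ.+ + 3) ++ V± k (+ k ℤ.- + 1))
Sphere₄ k = Sph k 4 (U± k (+ 4) ++ U± k (+ k ℤ.- + 1) ++ U± k (+ k ℤ.+ + 1) ++ U± k (+ 2 ℤ.* + k)
                     ++ V± k (+ 3) ++ V± k (+ k) ++ V± k (+ k ℤ.+ + 4) ++ V± k (+ k ℤ.- + 2))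
Sphere₅ k = Sph k 5 (U± k (+ 5) ++ U± k (+ k) ++ U± k (+ k ℤ.+ + 4) ++ U± k (+ k ℤ.- + 2)
                     ++ V± k (+ 4) ++ V± k (+ k ℤ.+ + 5) ++ V± k (+ k ℤ.- + 3))

-- k = 13 + j, so that the indices k - 1, k - 2, k - 3 of the statement compute to naturals
module Level₁ (j : ℕ) where
  K : ℕ
  K = 13 + j

  open Spheres K (5≤13+j j)

  blocks : List Block
  blocks = pair outer (+ 1) ∷ single inner (+ 0) neg-at0 ∷ []

  completeU : ∀ r → r + r ≤ N K → LevelU K r 1 → r ∈ 1 ∷ []
  completeU r _ (by-rim refl _) = here refl
  completeU r _ (by-inner² _ _ (s≤s ()))
  completeU r _ (at-k _ ())
  completeU r _ (at-k+1 _ ())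
  completeU r _ (by-inner _ (s≤s ()) _)

  soundU : ∀ r → r ∈ 1 ∷ [] → LevelU K r 1
  soundU r (here refl) = by-rim refl (s≤s (s≤s z≤n))

  completeV : ∀ r → r + r ≤ N K → LevelV K r 1 → r ∈ 0 ∷ []
  completeV r _ (by-rim refl _) = here refl
  completeV r _ (by-inner² _ _ (s≤s ()))
  completeV r _ (at-k _ ())
  completeV r _ (at-k+1 _ ())
  completeV r _ (by-inner _ (s≤s ()) _)

  soundV : ∀ r → r ∈ 0 ∷ [] → LevelV K r 1
  soundV r (here refl) = by-rim refl (s≤s (s≤s z≤n))

  sphere : Sphere₁ K
  sphere = sphere-by-levels 1 blocks refl refl completeU soundU completeV soundV

module Level₂ (j : ℕ) where
  K : ℕ
  K = 13 + j

  open Spheres K (5≤13+j j)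

  blocks : List Block
  blocks = pair outer (+ 2) ∷ pair inner (+ 1) ∷ pair inner (+ (K + 2)) ∷ []

  radii-v : radii inner blocks ≡ 1 ∷ K + 2 ∷ []
  radii-v = refl ∷≡ radius-%-by (K + 2) (12 + j) (identity j) ∷≡ refl
    where identity : ∀ j → (13 + j + 2) + (13 + j + 2) + (12 + j) ≡ suc (suc (suc (3 * (13 + j))))
          identity = solve-∀

  completeU : ∀ r → r + r ≤ N K → LevelU K r 2 → r ∈ 2 ∷ []
  completeU r _ (by-rim refl _) = here refl
  completeU r _ (by-inner² _ _ (s≤s (s≤s ())))
  completeU r _ (at-k _ ())
  completeU r _ (at-k+1 _ ())
  completeU r _ (by-inner _ (s≤s (s≤s ())) _)

  soundU : ∀ r → r ∈ 2 ∷ [] → LevelU K r 2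
  soundU r (here refl) = by-rim refl (m≤m+n 4 (9 + (j + 3)))

  completeV : ∀ r → r + r ≤ N K → LevelV K r 2 → r ∈ 1 ∷ K + 2 ∷ []
  completeV r _ (by-rim refl _) = here refl
  completeV r _ (by-inner² _ _ (s≤s (s≤s ())))
  completeV r _ (at-k _ ())
  completeV r _ (at-k+1 _ ())
  completeV r _ (by-inner r≡K+2 _ _) = there (here r≡K+2)

  soundV : ∀ r → r ∈ 1 ∷ K + 2 ∷ [] → LevelV K r 2
  soundV r (here refl) = by-rim refl (m≤m+n 4 (9 + (j + 3)))
  soundV r (there (here refl)) = by-inner refl ≤-refl (m≤m+n 4 (9 + (j + 3)))

  sphere : Sphere₂ K
  sphere = sphere-by-levels 2 blocks refl radii-v completeU soundU completeV soundV

module Level₃ (j : ℕ) where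
  K : ℕ
  K = 13 + j

  open Spheres K (5≤13+j j)

  blocks : List Block
  blocks = pair outer (+ 3) ∷ pair outer (+ (K + 2)) ∷ pair inner (+ 2) ∷ pair inner (+ (K + 1))
           ∷ pair inner (+ (K + 3)) ∷ pair inner (+ (12 + j)) ∷ []

  radii-u : radii outer blocks ≡ 3 ∷ K + 2 ∷ []
  radii-u = refl ∷≡ radius-%-by (K + 2) (12 + j) (identity j) ∷≡ refl
    where identity : ∀ j → (13 + j + 2) + (13 + j + 2) + (12 + j) ≡ suc (suc (suc (3 * (13 + j))))
          identity = solve-∀

  radii-v : radii inner blocks ≡ 2 ∷ K + 1 ∷ K + 3 ∷ 12 + j ∷ []
  radii-v = refl ∷≡ radius-%-by (K + 1) (14 + j) (identity₁ j) ∷≡ radius-%-by (K + 3) (10 + j) (identity₂ j)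
                            ∷≡ radius-%-by (12 + j) (18 + j) (identity₃ j) ∷≡ refl
    where identity₁ : ∀ j → (13 + j + 1) + (13 + j + 1) + (14 + j) ≡ suc (suc (suc (3 * (13 + j))))
          identity₁ = solve-∀
          identity₂ : ∀ j → (13 + j + 3) + (13 + j + 3) + (10 + j) ≡ suc (suc (suc (3 * (13 + j))))
          identity₂ = solve-∀
          identity₃ : ∀ j → (12 + j) + (12 + j) + (18 + j) ≡ suc (suc (suc (3 * (13 + j))))
          identity₃ = solve-∀

  K+3≡K+2+1 : K + 3 ≡ K + 2 + 1
  K+3≡K+2+1 = sym (+-assoc K 2 1)

  completeU : ∀ r → r + r ≤ N K → LevelU K r 3 → r ∈ 3 ∷ K + 2 ∷ []
  completeU r _ (by-rim refl _) = here refl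
  completeU r _ (by-inner² _ _ (s≤s (s≤s (s≤s ()))))
  completeU r _ (at-k _ ())
  completeU r _ (at-k+1 _ ())
  completeU r _ (by-inner r+1≡K+3 _ _) = there (here (+-cancelʳ-≡ 1 r (K + 2) (trans r+1≡K+3 K+3≡K+2+1)))

  soundU : ∀ r → r ∈ 3 ∷ K + 2 ∷ [] → LevelU K r 3
  soundU r (here refl) = by-rim refl (m≤m+n 6 (7 + (j + 3)))
  soundU r (there (here refl)) = by-inner (sym K+3≡K+2+1) ≤-refl (m≤m+n 6 (7 + (j + 5)))

  completeV : ∀ r → r + r ≤ N K → LevelV K r 3 → r ∈ 2 ∷ K + 1 ∷ K + 3 ∷ 12 + j ∷ []
  completeV r _ (by-rim refl _) = here refl
  completeV r _ (by-inner² r+3≡K+2 _ _) = there (there (there (here (+-cancelʳ-≡ 3 r (12 + j) (trans r+3≡K+2 (identity j))))))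
    where identity : ∀ j → 13 + j + 2 ≡ 12 + j + 3
          identity = solve-∀
  completeV r _ (at-k _ ())
  completeV r _ (at-k+1 refl _) = there (here (+-comm 1 K))
  completeV r _ (by-inner r≡K+3 _ _) = there (there (here r≡K+3))

  soundV : ∀ r → r ∈ 2 ∷ K + 1 ∷ K + 3 ∷ 12 + j ∷ [] → LevelV K r 3
  soundV r (here refl) = by-rim refl (m≤m+n 6 (7 + (j + 3)))
  soundV r (there (here refl)) = at-k+1 (+-comm K 1) refl
  soundV r (there (there (here refl))) = by-inner refl (s≤s (s≤s z≤n)) (m≤m+n 6 (7 + (j + 3)))
  soundV r (there (there (there (here refl)))) = by-inner² (identity j) (m≤m+n 6 (7 + (j + 3))) ≤-refl
    where identity : ∀ j → 12 + j + 3 ≡ 13 + j + 2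
          identity = solve-∀

  sphere : Sphere₃ K
  sphere = sphere-by-levels 3 blocks radii-u radii-v completeU soundU completeV soundV

module Level₄ (j : ℕ) where
  K : ℕ
  K = 13 + j

  open Spheres K (5≤13+j j)

  blocks : List Block
  blocks = pair outer (+ 4) ∷ pair outer (+ (12 + j)) ∷ pair outer (+ (K + 1)) ∷ pair outer (+ (2 * K))
           ∷ pair inner (+ 3) ∷ pair inner (+ K) ∷ pair inner (+ (K + 4)) ∷ pair inner (+ (11 + j)) ∷ []

  radii-u : radii outer blocks ≡ 4 ∷ 12 + j ∷ K + 1 ∷ K + 3 ∷ []
  radii-u = refl ∷≡ radius-%-by (12 + j) (18 + j) (identity₁ j) ∷≡ radius-%-by (K + 1) (14 + j) (identity₂ j)
                            ∷≡ radius-%-opposite (2 * K) (K + 3) (identity₃ j) (s≤s z≤n) (m+n≡o⇒m≤o (identity₄ j)) ∷≡ refl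
    where identity₁ : ∀ j → (12 + j) + (12 + j) + (18 + j) ≡ suc (suc (suc (3 * (13 + j))))
          identity₁ = solve-∀
          identity₂ : ∀ j → (13 + j + 1) + (13 + j + 1) + (14 + j) ≡ suc (suc (suc (3 * (13 + j))))
          identity₂ = solve-∀
          identity₃ : ∀ j → 2 * (13 + j) + (13 + j + 3) ≡ suc (suc (suc (3 * (13 + j))))
          identity₃ = solve-∀
          identity₄ : ∀ j → 13 + j + 3 + (10 + j) ≡ 2 * (13 + j)
          identity₄ = solve-∀

  radii-v : radii inner blocks ≡ 3 ∷ K ∷ K + 4 ∷ 11 + j ∷ []
  radii-v = refl ∷≡ radius-%-by K (16 + j) (identity₁ j) ∷≡ radius-%-by (K + 4) (8 + j) (identity₂ j)
                            ∷≡ radius-%-by (11 + j) (20 + j) (identity₃ j) ∷≡ refl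
    where identity₁ : ∀ j → (13 + j) + (13 + j) + (16 + j) ≡ suc (suc (suc (3 * (13 + j))))
          identity₁ = solve-∀
          identity₂ : ∀ j → (13 + j + 4) + (13 + j + 4) + (8 + j) ≡ suc (suc (suc (3 * (13 + j))))
          identity₂ = solve-∀
          identity₃ : ∀ j → (11 + j) + (11 + j) + (20 + j) ≡ suc (suc (suc (3 * (13 + j))))
          identity₃ = solve-∀

  shift₁ : ∀ j → 13 + j + 3 ≡ 12 + j + 4
  shift₁ = solve-∀

  shift₂ : ∀ j → 13 + j + 4 ≡ 13 + j + 3 + 1
  shift₂ = solve-∀

  shift₃ : ∀ j → 13 + j + 2 ≡ 11 + j + 4
  shift₃ = solve-∀

  completeU : ∀ r → r + r ≤ N K → LevelU K r 4 → r ∈ 4 ∷ 12 + j ∷ K + 1 ∷ K + 3 ∷ []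
  completeU r _ (by-rim refl _) = here refl
  completeU r _ (by-inner² r+4≡K+3 _ _) = there (here (+-cancelʳ-≡ 4 r (12 + j) (trans r+4≡K+3 (shift₁ j))))
  completeU r _ (at-k _ ())
  completeU r _ (at-k+1 refl _) = there (there (here (+-comm 1 K)))
  completeU r _ (by-inner r+1≡K+4 _ _) = there (there (there (here (+-cancelʳ-≡ 1 r (K + 3) (trans r+1≡K+4 (shift₂ j))))))

  soundU : ∀ r → r ∈ 4 ∷ 12 + j ∷ K + 1 ∷ K + 3 ∷ [] → LevelU K r 4
  soundU r (here refl) = by-rim refl (m≤m+n 8 (5 + (j + 3)))
  soundU r (there (here refl)) = by-inner² (sym (shift₁ j)) (m≤m+n 8 (5 + (j + 3))) ≤-refl
  soundU r (there (there (here refl))) = at-k+1 (+-comm K 1) refl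
  soundU r (there (there (there (here refl)))) = by-inner (sym (shift₂ j)) (s≤s (s≤s (s≤s z≤n))) (m≤m+n 8 (5 + (j + 5)))

  completeV : ∀ r → r + r ≤ N K → LevelV K r 4 → r ∈ 3 ∷ K ∷ K + 4 ∷ 11 + j ∷ []
  completeV r _ (by-rim refl _) = here refl
  completeV r _ (by-inner² r+4≡K+2 _ _) = there (there (there (here (+-cancelʳ-≡ 4 r (11 + j) (trans r+4≡K+2 (shift₃ j))))))
  completeV r _ (at-k refl _) = there (here refl)
  completeV r _ (at-k+1 _ ())
  completeV r _ (by-inner r≡K+4 _ _) = there (there (here r≡K+4))

  soundV : ∀ r → r ∈ 3 ∷ K ∷ K + 4 ∷ 11 + j ∷ [] → LevelV K r 4
  soundV r (here refl) = by-rim refl (m≤m+n 8 (5 + (j + 3)))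
  soundV r (there (here refl)) = at-k refl refl
  soundV r (there (there (here refl))) = by-inner refl (s≤s (s≤s z≤n)) (m≤m+n 8 (5 + (j + 3)))
  soundV r (there (there (there (here refl)))) = by-inner² (sym (shift₃ j)) (m≤m+n 8 (5 + (j + 3))) (s≤s (s≤s (s≤s z≤n)))

  sphere : Sphere₄ K
  sphere = sphere-by-levels 4 blocks radii-u radii-v completeU soundU completeV soundV

module Level₅ (j : ℕ) where
  K : ℕ
  K = 13 + j

  open Spheres K (5≤13+j j)

  blocks : List Block
  blocks = pair outer (+ 5) ∷ pair outer (+ K) ∷ pair outer (+ (K + 4)) ∷ pair outer (+ (11 + j))
           ∷ pair inner (+ 4) ∷ pair inner (+ (K + 5)) ∷ pair inner (+ (10 + j)) ∷ []

  radii-u : radii outer blocks ≡ 5 ∷ K ∷ K + 4 ∷ 11 + j ∷ []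
  radii-u = refl ∷≡ radius-%-by K (16 + j) (identity₁ j) ∷≡ radius-%-by (K + 4) (8 + j) (identity₂ j)
                            ∷≡ radius-%-by (11 + j) (20 + j) (identity₃ j) ∷≡ refl
    where identity₁ : ∀ j → (13 + j) + (13 + j) + (16 + j) ≡ suc (suc (suc (3 * (13 + j))))
          identity₁ = solve-∀
          identity₂ : ∀ j → (13 + j + 4) + (13 + j + 4) + (8 + j) ≡ suc (suc (suc (3 * (13 + j))))
          identity₂ = solve-∀
          identity₃ : ∀ j → (11 + j) + (11 + j) + (20 + j) ≡ suc (suc (suc (3 * (13 + j))))
          identity₃ = solve-∀

  radii-v : radii inner blocks ≡ 4 ∷ K + 5 ∷ 10 + j ∷ []
  radii-v = refl ∷≡ radius-%-by (K + 5) (6 + j) (identity₁ j) ∷≡ radius-%-by (10 + j) (22 + j) (identity₂ j) ∷≡ refl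
    where identity₁ : ∀ j → (13 + j + 5) + (13 + j + 5) + (6 + j) ≡ suc (suc (suc (3 * (13 + j))))
          identity₁ = solve-∀
          identity₂ : ∀ j → (10 + j) + (10 + j) + (22 + j) ≡ suc (suc (suc (3 * (13 + j))))
          identity₂ = solve-∀

  shift₁ : ∀ j → 13 + j + 3 ≡ 11 + j + 5
  shift₁ = solve-∀

  shift₂ : ∀ j → 13 + j + 5 ≡ 13 + j + 4 + 1
  shift₂ = solve-∀

  shift₃ : ∀ j → 13 + j + 2 ≡ 10 + j + 5
  shift₃ = solve-∀

  completeU : ∀ r → r + r ≤ N K → LevelU K r 5 → r ∈ 5 ∷ K ∷ K + 4 ∷ 11 + j ∷ []
  completeU r _ (by-rim refl _) = here refl
  completeU r _ (by-inner² r+5≡K+3 _ _) = there (there (there (here (+-cancelʳ-≡ 5 r (11 + j) (trans r+5≡K+3 (shift₁ j))))))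
  completeU r _ (at-k refl _) = there (here refl)
  completeU r _ (at-k+1 _ ())
  completeU r _ (by-inner r+1≡K+5 _ _) = there (there (here (+-cancelʳ-≡ 1 r (K + 4) (trans r+1≡K+5 (shift₂ j)))))

  soundU : ∀ r → r ∈ 5 ∷ K ∷ K + 4 ∷ 11 + j ∷ [] → LevelU K r 5
  soundU r (here refl) = by-rim refl (m≤m+n 10 (3 + (j + 3)))
  soundU r (there (here refl)) = at-k refl refl
  soundU r (there (there (here refl))) = by-inner (sym (shift₂ j)) (s≤s (s≤s (s≤s z≤n))) (m≤m+n 10 (3 + (j + 5)))
  soundU r (there (there (there (here refl)))) = by-inner² (sym (shift₁ j)) (m≤m+n 10 (3 + (j + 3))) (s≤s (s≤s (s≤s (s≤s z≤n))))

  completeV : ∀ r → r + r ≤ N K → LevelV K r 5 → r ∈ 4 ∷ K + 5 ∷ 10 + j ∷ []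
  completeV r _ (by-rim refl _) = here refl
  completeV r _ (by-inner² r+5≡K+2 _ _) = there (there (here (+-cancelʳ-≡ 5 r (10 + j) (trans r+5≡K+2 (shift₃ j)))))
  completeV r _ (at-k _ ())
  completeV r _ (at-k+1 _ ())
  completeV r _ (by-inner r≡K+5 _ _) = there (here r≡K+5)

  soundV : ∀ r → r ∈ 4 ∷ K + 5 ∷ 10 + j ∷ [] → LevelV K r 5
  soundV r (here refl) = by-rim refl (m≤m+n 10 (3 + (j + 3)))
  soundV r (there (here refl)) = by-inner refl (s≤s (s≤s z≤n)) (m≤m+n 10 (3 + (j + 3)))
  soundV r (there (there (here refl))) = by-inner² (sym (shift₃ j)) (m≤m+n 10 (3 + (j + 3))) (s≤s (s≤s (s≤s z≤n)))

  sphere : Sphere₅ K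
  sphere = sphere-by-levels 5 blocks radii-u radii-v completeU soundU completeV soundV

middle-bound : ∀ {k a} → 6 + a ≤ ⌈ suc k /2⌉ → 10 + (a + a) ≤ k
middle-bound {k} {a} i≤b = subst (_≤ k) (identity a) (≤-trans (+-mono-≤ 5+a≤⌊k/2⌋ 5+a≤⌊k/2⌋) (⌊n/2⌋+⌊n/2⌋≤n k))
  where
    5+a≤⌊k/2⌋ : 5 + a ≤ ⌊ k /2⌋
    5+a≤⌊k/2⌋ = ℕ.s≤s⁻¹ i≤b
    identity : ∀ a → 5 + a + (5 + a) ≡ 10 + (a + a)
    identity = solve-∀

middle-view : ∀ {k i} → 6 ≤ i → i ≤ ⌈ suc k /2⌉ → ∃₂ λ a q → 6 + a ≡ i × 10 + (a + a) + q ≡ k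
middle-view {k} {i} 6≤i i≤b = a , q , 6+a≡i , 10+2a+q≡k
  where
    a q : ℕ
    a = proj₁ (m≤n⇒∃[o]m+o≡n 6≤i)
    6+a≡i : 6 + a ≡ i
    6+a≡i = proj₂ (m≤n⇒∃[o]m+o≡n 6≤i)
    10+2a≤k : 10 + (a + a) ≤ k
    10+2a≤k = middle-bound {k} (subst (_≤ ⌈ suc k /2⌉) (sym 6+a≡i) i≤b)
    q = proj₁ (m≤n⇒∃[o]m+o≡n 10+2a≤k)
    10+2a+q≡k : 10 + (a + a) + q ≡ k
    10+2a+q≡k = proj₂ (m≤n⇒∃[o]m+o≡n 10+2a≤k)

SphereMiddle : ℕ → ℕ → Set
SphereMiddle k i = Sph k i (U± k (+ i) ++ V± k (+ i ℤ.- + 1) ++ U± k (+ k ℤ.+ + i ℤ.- + 1)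
                            ++ U± k (+ 2 ℤ.* + k ℤ.+ + i) ++ V± k (+ 2 ℤ.* + k ℤ.+ + i ℤ.+ + 1)
                            ++ V± k (+ k ℤ.+ + i))

module Middle (a q : ℕ) where
  K : ℕ
  K = 10 + (a + a) + q

  open Spheres K (m≤m+n 5 (5 + (a + a) + q))

  blocks : List Block
  blocks = pair outer (+ (6 + a)) ∷ pair inner (+ (6 + a) ℤ.- + 1) ∷ pair outer (+ K ℤ.+ + (6 + a) ℤ.- + 1)
           ∷ pair outer (+ 2 ℤ.* + K ℤ.+ + (6 + a)) ∷ pair inner (+ 2 ℤ.* + K ℤ.+ + (6 + a) ℤ.+ + 1)
           ∷ pair inner (+ K ℤ.+ + (6 + a)) ∷ []

  n≡ : ∀ a q → suc (suc (suc (3 * (10 + (a + a) + q)))) ≡ 33 + 6 * a + 3 * q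
  n≡ = solve-∀

  ≡n : ∀ {x} → x ≡ 33 + 6 * a + 3 * q → x ≡ N K
  ≡n e = trans e (sym (n≡ a q))

  radii-u : radii outer blocks ≡ 6 + a ∷ 9 + (a + a) + q + (6 + a) ∷ 7 + a + q ∷ []
  radii-u = radius-%-by (6 + a) (21 + 4 * a + 3 * q) (≡n (identity₁ a q))
            ∷≡ radius-%-by (9 + (a + a) + q + (6 + a)) (3 + q) (≡n (identity₂ a q))
            ∷≡ radius-%-opposite (2 * K + (6 + a)) (7 + a + q) (≡n (identity₃ a q)) (s≤s z≤n) (m+n≡o⇒m≤o (identity₄ a q))
            ∷≡ refl
    where identity₁ : ∀ a q → (6 + a) + (6 + a) + (21 + 4 * a + 3 * q) ≡ 33 + 6 * a + 3 * q
          identity₁ = solve-∀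
          identity₂ : ∀ a q → (9 + (a + a) + q + (6 + a)) + (9 + (a + a) + q + (6 + a)) + (3 + q) ≡ 33 + 6 * a + 3 * q
          identity₂ = solve-∀
          identity₃ : ∀ a q → 2 * (10 + (a + a) + q) + (6 + a) + (7 + a + q) ≡ 33 + 6 * a + 3 * q
          identity₃ = solve-∀
          identity₄ : ∀ a q → 7 + a + q + (19 + 4 * a + q) ≡ 2 * (10 + (a + a) + q) + (6 + a)
          identity₄ = solve-∀

  radii-v : radii inner blocks ≡ 5 + a ∷ 6 + a + q ∷ K + (6 + a) ∷ []
  radii-v = radius-%-by (5 + a) (23 + 4 * a + 3 * q) (≡n (identity₁ a q))
            ∷≡ radius-%-opposite (2 * K + (6 + a) + 1) (6 + a + q) (≡n (identity₂ a q)) (s≤s z≤n) (m+n≡o⇒m≤o (identity₃ a q))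
            ∷≡ radius-%-by (K + (6 + a)) (1 + q) (≡n (identity₄ a q))
            ∷≡ refl
    where identity₁ : ∀ a q → (5 + a) + (5 + a) + (23 + 4 * a + 3 * q) ≡ 33 + 6 * a + 3 * q
          identity₁ = solve-∀
          identity₂ : ∀ a q → 2 * (10 + (a + a) + q) + (6 + a) + 1 + (6 + a + q) ≡ 33 + 6 * a + 3 * q
          identity₂ = solve-∀
          identity₃ : ∀ a q → 6 + a + q + (21 + 4 * a + q) ≡ 2 * (10 + (a + a) + q) + (6 + a) + 1
          identity₃ = solve-∀
          identity₄ : ∀ a q → (10 + (a + a) + q + (6 + a)) + (10 + (a + a) + q + (6 + a)) + (1 + q) ≡ 33 + 6 * a + 3 * q
          identity₄ = solve-∀

  shift₁ : ∀ a q → 10 + (a + a) + q + 3 ≡ 7 + a + q + (6 + a)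
  shift₁ = solve-∀

  shift₂ : ∀ a q → 10 + (a + a) + q + (6 + a) ≡ 9 + (a + a) + q + (6 + a) + 1
  shift₂ = solve-∀

  shift₃ : ∀ a q → 10 + (a + a) + q + 2 ≡ 6 + a + q + (6 + a)
  shift₃ = solve-∀

  2i≤K+3 : (6 + a) + (6 + a) ≤ K + 3
  2i≤K+3 = m+n≡o⇒m≤o (identity a q)
    where identity : ∀ a q → (6 + a) + (6 + a) + (1 + q) ≡ 10 + (a + a) + q + 3
          identity = solve-∀

  2i≤K+5 : (6 + a) + (6 + a) ≤ K + 5
  2i≤K+5 = m+n≡o⇒m≤o (identity a q)
    where identity : ∀ a q → (6 + a) + (6 + a) + (3 + q) ≡ 10 + (a + a) + q + 5
          identity = solve-∀

  completeU : ∀ r → r + r ≤ N K → LevelU K r (6 + a) → r ∈ 6 + a ∷ 9 + (a + a) + q + (6 + a) ∷ 7 + a + q ∷ []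
  completeU r _ (by-rim refl _) = here refl
  completeU r _ (by-inner² r+i≡K+3 _ _) = there (there (here (+-cancelʳ-≡ (6 + a) r (7 + a + q) (trans r+i≡K+3 (shift₁ a q)))))
  completeU r _ (at-k _ ())
  completeU r _ (at-k+1 _ ())
  completeU r _ (by-inner r+1≡K+i _ _) = there (here (+-cancelʳ-≡ 1 r _ (trans r+1≡K+i (shift₂ a q))))

  soundU : ∀ r → r ∈ 6 + a ∷ 9 + (a + a) + q + (6 + a) ∷ 7 + a + q ∷ [] → LevelU K r (6 + a)
  soundU r (here refl) = by-rim refl 2i≤K+3
  soundU r (there (here refl)) = by-inner (sym (shift₂ a q)) (m≤m+n 3 (3 + a)) 2i≤K+5
  soundU r (there (there (here refl))) = by-inner² (sym (shift₁ a q)) 2i≤K+3 (m≤m+n 4 (2 + a))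

  completeV : ∀ r → r + r ≤ N K → LevelV K r (6 + a) → r ∈ 5 + a ∷ 6 + a + q ∷ K + (6 + a) ∷ []
  completeV r _ (by-rim refl _) = here refl
  completeV r _ (by-inner² r+i≡K+2 _ _) = there (here (+-cancelʳ-≡ (6 + a) r (6 + a + q) (trans r+i≡K+2 (shift₃ a q))))
  completeV r _ (at-k _ ())
  completeV r _ (at-k+1 _ ())
  completeV r _ (by-inner r≡K+i _ _) = there (there (here r≡K+i))

  soundV : ∀ r → r ∈ 5 + a ∷ 6 + a + q ∷ K + (6 + a) ∷ [] → LevelV K r (6 + a)
  soundV r (here refl) = by-rim refl 2i≤K+3
  soundV r (there (here refl)) = by-inner² (sym (shift₃ a q)) 2i≤K+3 (m≤m+n 3 (3 + a))
  soundV r (there (there (here refl))) = by-inner refl (m≤m+n 2 (4 + a)) 2i≤K+3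

  sphere : SphereMiddle K (6 + a)
  sphere = sphere-by-levels (6 + a) blocks radii-u radii-v completeU soundU completeV soundV

SpheresOdd : ℕ → Set
SpheresOdd k = Sph k (suc ⌈ suc k /2⌉)
                   (U± k (+ ⌊ 3 + k /2⌋) ++ V± k (+ ⌊ 1 + k /2⌋) ++ U± k (+ ⌊ 1 + 3 * k /2⌋)
                    ++ V k (+ ⌊ 3 + 3 * k /2⌋) ∷ [])
             × Sph k (2 + ⌈ suc k /2⌉) (U k (+ ⌊ 3 + 3 * k /2⌋) ∷ [])
             × (∀ i → 2 + ⌈ suc k /2⌉ < i → Sph k i [])

⌊[c+c]/2⌋≡c : ∀ c → ⌊ c + c /2⌋ ≡ c
⌊[c+c]/2⌋≡c c = sym (n≡⌊n+n/2⌋ c)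

module Odd (c : ℕ) where
  K H : ℕ
  K = 13 + (c + c)
  H = 21 + 3 * c

  open Spheres K (m≤m+n 5 (8 + (c + c)))

  b≡7+c : ⌈ suc K /2⌉ ≡ 7 + c
  b≡7+c = cong (λ x → 7 + x) (sym (n≡⌈n+n/2⌉ c))

  ⌊3K+3/2⌋≡H : ⌊ 3 + 3 * K /2⌋ ≡ H
  ⌊3K+3/2⌋≡H = trans (cong ⌊_/2⌋ (identity c)) (⌊[c+c]/2⌋≡c H)
    where identity : ∀ c → 3 + 3 * (13 + (c + c)) ≡ (21 + 3 * c) + (21 + 3 * c)
          identity = solve-∀

  n≡2H : N K ≡ H + H
  n≡2H = identity c
    where identity : ∀ c → suc (suc (suc (3 * (13 + (c + c))))) ≡ (21 + 3 * c) + (21 + 3 * c)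
          identity = solve-∀

  antipode-fixed : neg (ix (N K) (+ ⌊ 3 + 3 * K /2⌋)) ≡ ix (N K) (+ ⌊ 3 + 3 * K /2⌋)
  antipode-fixed = subst (λ h → neg (at h) ≡ at h) (sym ⌊3K+3/2⌋≡H) (neg-at-half H (sym n≡2H))

  radius-H : radius (⌊ 3 + 3 * K /2⌋ % N K) ≡ H
  radius-H = trans (cong (λ h → radius (h % N K)) ⌊3K+3/2⌋≡H) (radius-% H (≤-reflexive (sym n≡2H)))

  radius-floor : ∀ {x} a w → x ≡ a → a + a + w ≡ N K → radius (x % N K) ≡ a
  radius-floor a w refl e = radius-%-by a w e

  2[8+c]≡K+3 : (8 + c) + (8 + c) ≡ K + 3
  2[8+c]≡K+3 = identity c
    where identity : ∀ c → (8 + c) + (8 + c) ≡ 13 + (c + c) + 3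
          identity = solve-∀

  2[9+c]≡K+3+2 : (9 + c) + (9 + c) ≡ K + 3 + 2
  2[9+c]≡K+3+2 = identity c
    where identity : ∀ c → (9 + c) + (9 + c) ≡ 13 + (c + c) + 3 + 2
          identity = solve-∀

  shift₁ : ∀ c → 13 + (c + c) + 3 ≡ 8 + c + (8 + c)
  shift₁ = solve-∀

  shift₂ : ∀ c → 13 + (c + c) + (8 + c) ≡ 20 + 3 * c + 1
  shift₂ = solve-∀

  shift₃ : ∀ c → 13 + (c + c) + 2 ≡ 7 + c + (8 + c)
  shift₃ = solve-∀

  shift₄ : ∀ c → 13 + (c + c) + (8 + c) ≡ 21 + 3 * c
  shift₄ = solve-∀

  shift₅ : ∀ c → 13 + (c + c) + (9 + c) ≡ 21 + 3 * c + 1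
  shift₅ = solve-∀

  blocks-b+1 : List Block
  blocks-b+1 = pair outer (+ ⌊ 3 + K /2⌋) ∷ pair inner (+ ⌊ 1 + K /2⌋) ∷ pair outer (+ ⌊ 1 + 3 * K /2⌋)
               ∷ single inner (+ ⌊ 3 + 3 * K /2⌋) antipode-fixed ∷ []

  radii-u : radii outer blocks-b+1 ≡ 8 + c ∷ 20 + 3 * c ∷ []
  radii-u = radius-floor (8 + c) (26 + 4 * c) (cong (λ x → 8 + x) (⌊[c+c]/2⌋≡c c)) (identity₁ c)
            ∷≡ radius-floor (20 + 3 * c) 2 (trans (cong ⌊_/2⌋ (identity₂ c)) (⌊[c+c]/2⌋≡c (20 + 3 * c))) (identity₃ c)
            ∷≡ refl
    where identity₁ : ∀ c → (8 + c) + (8 + c) + (26 + 4 * c) ≡ suc (suc (suc (3 * (13 + (c + c)))))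
          identity₁ = solve-∀
          identity₂ : ∀ c → 1 + 3 * (13 + (c + c)) ≡ (20 + 3 * c) + (20 + 3 * c)
          identity₂ = solve-∀
          identity₃ : ∀ c → (20 + 3 * c) + (20 + 3 * c) + 2 ≡ suc (suc (suc (3 * (13 + (c + c)))))
          identity₃ = solve-∀

  radii-v : radii inner blocks-b+1 ≡ 7 + c ∷ H ∷ []
  radii-v = radius-floor (7 + c) (28 + 4 * c) (cong (λ x → 7 + x) (⌊[c+c]/2⌋≡c c)) (identity c) ∷≡ radius-H ∷≡ refl
    where identity : ∀ c → (7 + c) + (7 + c) + (28 + 4 * c) ≡ suc (suc (suc (3 * (13 + (c + c)))))
          identity = solve-∀

  completeU : ∀ r → r + r ≤ N K → LevelU K r (8 + c) → r ∈ 8 + c ∷ 20 + 3 * c ∷ []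
  completeU r _ (by-rim refl _) = here refl
  completeU r _ (by-inner² r+d≡K+3 _ _) = here (+-cancelʳ-≡ (8 + c) r (8 + c) (trans r+d≡K+3 (shift₁ c)))
  completeU r _ (at-k _ ())
  completeU r _ (at-k+1 _ ())
  completeU r _ (by-inner r+1≡K+d _ _) = there (here (+-cancelʳ-≡ 1 r (20 + 3 * c) (trans r+1≡K+d (shift₂ c))))

  soundU : ∀ r → r ∈ 8 + c ∷ 20 + 3 * c ∷ [] → LevelU K r (8 + c)
  soundU r (here refl) = by-rim refl (≤-reflexive 2[8+c]≡K+3)
  soundU r (there (here refl)) = by-inner (sym (shift₂ c)) (m≤m+n 3 (5 + c))
                                   (m+n≡o⇒m≤o (trans (cong (_+ 2) 2[8+c]≡K+3) (+-assoc K 3 2)))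

  completeV : ∀ r → r + r ≤ N K → LevelV K r (8 + c) → r ∈ 7 + c ∷ H ∷ []
  completeV r _ (by-rim refl _) = here refl
  completeV r _ (by-inner² r+d≡K+2 _ _) = here (+-cancelʳ-≡ (8 + c) r (7 + c) (trans r+d≡K+2 (shift₃ c)))
  completeV r _ (at-k _ ())
  completeV r _ (at-k+1 _ ())
  completeV r _ (by-inner r≡K+d _ _) = there (here (trans r≡K+d (shift₄ c)))

  soundV : ∀ r → r ∈ 7 + c ∷ H ∷ [] → LevelV K r (8 + c)
  soundV r (here refl) = by-rim refl (≤-reflexive 2[8+c]≡K+3)
  soundV r (there (here refl)) = by-inner (sym (shift₄ c)) (m≤m+n 2 (6 + c)) (≤-reflexive 2[8+c]≡K+3)

  L-b+1 L-b+2 : List (Vtx (N K))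
  L-b+1 = U± K (+ ⌊ 3 + K /2⌋) ++ V± K (+ ⌊ 1 + K /2⌋) ++ U± K (+ ⌊ 1 + 3 * K /2⌋) ++ V K (+ ⌊ 3 + 3 * K /2⌋) ∷ []
  L-b+2 = U K (+ ⌊ 3 + 3 * K /2⌋) ∷ []

  sphere-b+1 : Sph K (8 + c) L-b+1
  sphere-b+1 = sphere-by-levels (8 + c) blocks-b+1 radii-u radii-v completeU soundU completeV soundV

  too-far : ¬ ((9 + c) + (9 + c) ≤ K + 3)
  too-far 2d≤K+3 = m+1+n≰m (K + 3) (subst (_≤ K + 3) 2[9+c]≡K+3+2 2d≤K+3)

  completeU-b+2 : ∀ r → r + r ≤ N K → LevelU K r (9 + c) → r ∈ H ∷ []
  completeU-b+2 r _ (by-rim _ 2d≤K+3) = ⊥-elim (too-far 2d≤K+3)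
  completeU-b+2 r _ (by-inner² _ 2d≤K+3 _) = ⊥-elim (too-far 2d≤K+3)
  completeU-b+2 r _ (at-k _ ())
  completeU-b+2 r _ (at-k+1 _ ())
  completeU-b+2 r _ (by-inner r+1≡K+d _ _) = here (+-cancelʳ-≡ 1 r H (trans r+1≡K+d (shift₅ c)))

  soundU-b+2 : ∀ r → r ∈ H ∷ [] → LevelU K r (9 + c)
  soundU-b+2 r (here refl) = by-inner (sym (shift₅ c)) (m≤m+n 3 (6 + c)) (≤-reflexive (trans 2[9+c]≡K+3+2 (+-assoc K 3 2)))

  sphere-b+2 : Sph K (9 + c) L-b+2
  sphere-b+2 = sphere-by-levels (9 + c) (single outer (+ ⌊ 3 + 3 * K /2⌋) antipode-fixed ∷ []) (radius-H ∷≡ refl) refl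
                 completeU-b+2 soundU-b+2 (λ _ _ l → ⊥-elim (too-far (LevelV-bound (m≤m+n 5 (8 + (c + c))) l))) (λ _ ())

  sphere-beyond-b+2 : ∀ i → 2 + (7 + c) < i → Sph K i []
  sphere-beyond-b+2 i 10+c≤i = sphere-beyond i (≤-certified 0 1 (+-mono-≤ 10+c≤i 10+c≤i) (identity c i))
    where identity : ∀ c i → 1 * (i + i) + (10 + c + (10 + c)) ≡ 1 * suc (13 + (c + c) + 5) + (i + i) + 1
          identity = solve-∀

  spheres : SpheresOdd K
  spheres = subst (λ b → Sph K (suc b) L-b+1) (sym b≡7+c) sphere-b+1 ,
            subst (λ b → Sph K (2 + b) L-b+2) (sym b≡7+c) sphere-b+2 ,
            λ i b+2<i → sphere-beyond-b+2 i (subst (λ b → 2 + b < i) b≡7+c b+2<i)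

SpheresEven : ℕ → Set
SpheresEven k = Sph k (suc ⌈ suc k /2⌉) (U± k (+ ⌊ 2 + 3 * k /2⌋))
              × (∀ i → suc ⌈ suc k /2⌉ < i → Sph k i [])

module Even (c : ℕ) where
  K : ℕ
  K = 14 + (c + c)

  open Spheres K (m≤m+n 5 (9 + (c + c)))

  b≡8+c : ⌈ suc K /2⌉ ≡ 8 + c
  b≡8+c = cong (λ x → 8 + x) (⌊[c+c]/2⌋≡c c)

  ⌊3K+2/2⌋ : ⌊ 2 + 3 * K /2⌋ ≡ 22 + 3 * c
  ⌊3K+2/2⌋ = trans (cong ⌊_/2⌋ (identity c)) (⌊[c+c]/2⌋≡c (22 + 3 * c))
    where identity : ∀ c → 2 + 3 * (14 + (c + c)) ≡ (22 + 3 * c) + (22 + 3 * c)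
          identity = solve-∀

  shift₁ : ∀ c → 14 + (c + c) + (9 + c) ≡ 22 + 3 * c + 1
  shift₁ = solve-∀

  blocks : List Block
  blocks = pair outer (+ ⌊ 2 + 3 * K /2⌋) ∷ []

  radii-u : radii outer blocks ≡ 22 + 3 * c ∷ []
  radii-u = trans (cong (λ h → radius (h % N K)) ⌊3K+2/2⌋) (radius-%-by (22 + 3 * c) 1 (identity c)) ∷≡ refl
    where identity : ∀ c → (22 + 3 * c) + (22 + 3 * c) + 1 ≡ suc (suc (suc (3 * (14 + (c + c)))))
          identity = solve-∀

  too-far : ¬ ((9 + c) + (9 + c) ≤ K + 3)
  too-far 2d≤K+3 = m+1+n≰m (K + 3) (subst (_≤ K + 3) (identity c) 2d≤K+3)
    where identity : ∀ c → (9 + c) + (9 + c) ≡ 14 + (c + c) + 3 + 1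
          identity = solve-∀

  completeU : ∀ r → r + r ≤ N K → LevelU K r (9 + c) → r ∈ 22 + 3 * c ∷ []
  completeU r _ (by-rim _ 2d≤K+3) = ⊥-elim (too-far 2d≤K+3)
  completeU r _ (by-inner² _ 2d≤K+3 _) = ⊥-elim (too-far 2d≤K+3)
  completeU r _ (at-k _ ())
  completeU r _ (at-k+1 _ ())
  completeU r _ (by-inner r+1≡K+d _ _) = here (+-cancelʳ-≡ 1 r (22 + 3 * c) (trans r+1≡K+d (shift₁ c)))

  soundU : ∀ r → r ∈ 22 + 3 * c ∷ [] → LevelU K r (9 + c)
  soundU r (here refl) = by-inner (sym (shift₁ c)) (m≤m+n 3 (6 + c)) (m+n≡o⇒m≤o (identity c))
    where identity : ∀ c → (9 + c) + (9 + c) + 1 ≡ 14 + (c + c) + 5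
          identity = solve-∀

  L-b+1 : List (Vtx (N K))
  L-b+1 = U± K (+ ⌊ 2 + 3 * K /2⌋)

  sphere-b+1 : Sph K (9 + c) L-b+1
  sphere-b+1 = sphere-by-levels (9 + c) blocks radii-u refl completeU soundU
                 (λ _ _ l → ⊥-elim (too-far (LevelV-bound (m≤m+n 5 (9 + (c + c))) l))) (λ _ ())

  sphere-beyond-b+1 : ∀ i → suc (8 + c) < i → Sph K i []
  sphere-beyond-b+1 i 10+c≤i = sphere-beyond i (≤-certified 0 0 (+-mono-≤ 10+c≤i 10+c≤i) (identity c i))
    where identity : ∀ c i → 1 * (i + i) + (10 + c + (10 + c)) ≡ 1 * suc (14 + (c + c) + 5) + (i + i) + 0
          identity = solve-∀

  spheres : SpheresEven K
  spheres = subst (λ b → Sph K (suc b) L-b+1) (sym b≡8+c) sphere-b+1 ,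
            λ i b+1<i → sphere-beyond-b+1 i (subst (λ b → suc b < i) b≡8+c b+1<i)

from-13 : (P : ℕ → Set) → (∀ j → P (13 + j)) → ∀ k → 13 ≤ k → P k
from-13 P p k 13≤k = subst P (proj₂ (m≤n⇒∃[o]m+o≡n 13≤k)) (p _)

halves : ∀ {k r} → k % 2 ≡ r → r + (k / 2) * 2 ≡ k
halves {k} refl = sym (m≡m%n+[m/n]*n k 2)

odd-view : ∀ {k} → 13 ≤ k → k % 2 ≡ 1 → ∃ λ c → 13 + (c + c) ≡ k
odd-view {k} 13≤k odd = c , (begin
  13 + (c + c)         ≡⟨ identity c ⟩
  1 + (6 + c) * 2      ≡⟨ cong (λ h → 1 + h * 2) 6+c≡h ⟩
  1 + (k / 2) * 2      ≡⟨ halves odd ⟩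
  k                    ∎)
  where
    open ≡-Reasoning
    6≤h : 6 ≤ k / 2
    6≤h = ≤-certified 1 0 (subst (13 ≤_) (sym (halves odd)) 13≤k) (bound (k / 2))
      where bound : ∀ h → 2 * h + 13 ≡ 2 * 6 + (1 + h * 2) + 0
            bound = solve-∀
    c : ℕ
    c = proj₁ (m≤n⇒∃[o]m+o≡n 6≤h)
    6+c≡h : 6 + c ≡ k / 2
    6+c≡h = proj₂ (m≤n⇒∃[o]m+o≡n 6≤h)
    identity : ∀ c → 13 + (c + c) ≡ 1 + (6 + c) * 2
    identity = solve-∀

even-view : ∀ {k} → 13 ≤ k → k % 2 ≡ 0 → ∃ λ c → 14 + (c + c) ≡ k
even-view {k} 13≤k even = c , (begin
  14 + (c + c)         ≡⟨ identity c ⟩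
  0 + (7 + c) * 2      ≡⟨ cong (λ h → 0 + h * 2) 7+c≡h ⟩
  0 + (k / 2) * 2      ≡⟨ halves even ⟩
  k                    ∎)
  where
    open ≡-Reasoning
    7≤h : 7 ≤ k / 2
    7≤h = ≰⇒> λ h≤6 → <⇒≱ ≤-refl (≤-trans (subst (13 ≤_) (sym (halves even)) 13≤k) (*-monoˡ-≤ 2 h≤6))
    c : ℕ
    c = proj₁ (m≤n⇒∃[o]m+o≡n 7≤h)
    7+c≡h : 7 + c ≡ k / 2
    7+c≡h = proj₂ (m≤n⇒∃[o]m+o≡n 7≤h)
    identity : ∀ c → 14 + (c + c) ≡ 0 + (7 + c) * 2
    identity = solve-∀

lemma4p5 : (k : ℕ) → 13 ≤ k →
    -- (i)
    ( Sph k 1 (U± k (+ 1) ++ V k (+ 0) ∷ [])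
    × Sph k 2 (U± k (+ 2) ++ V± k (+ 1) ++ V± k (+ k ℤ.+ + 2))
    × Sph k 3 (U± k (+ 3) ++ U± k (+ k ℤ.+ + 2) ++ V± k (+ 2) ++ V± k (+ k ℤ.+ + 1)
               ++ V± k (+ k ℤ.+ + 3) ++ V± k (+ k ℤ.- + 1))
    × Sph k 4 (U± k (+ 4) ++ U± k (+ k ℤ.- + 1) ++ U± k (+ k ℤ.+ + 1) ++ U± k (+ 2 ℤ.* + k)
               ++ V± k (+ 3) ++ V± k (+ k) ++ V± k (+ k ℤ.+ + 4) ++ V± k (+ k ℤ.- + 2))
    × Sph k 5 (U± k (+ 5) ++ U± k (+ k) ++ U± k (+ k ℤ.+ + 4) ++ U± k (+ k ℤ.- + 2)
               ++ V± k (+ 4) ++ V± k (+ k ℤ.+ + 5) ++ V± k (+ k ℤ.- + 3)) )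
    -- (ii), with b = ⌈(k+1)/2⌉
    × (∀ i → 6 ≤ i → i ≤ ⌈ ℕ.suc k /2⌉ →
         Sph k i (U± k (+ i) ++ V± k (+ i ℤ.- + 1) ++ U± k (+ k ℤ.+ + i ℤ.- + 1)
                  ++ U± k (+ 2 ℤ.* + k ℤ.+ + i) ++ V± k (+ 2 ℤ.* + k ℤ.+ + i ℤ.+ + 1)
                  ++ V± k (+ k ℤ.+ + i)))
    -- (iii) k odd
    × (k % 2 ≡ 1 →
         Sph k (ℕ.suc ⌈ ℕ.suc k /2⌉)
           (U± k (+ ⌊ 3 ℕ.+ k /2⌋) ++ V± k (+ ⌊ 1 ℕ.+ k /2⌋) ++ U± k (+ ⌊ 1 ℕ.+ 3 ℕ.* k /2⌋)
            ++ V k (+ ⌊ 3 ℕ.+ 3 ℕ.* k /2⌋) ∷ [])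
       × Sph k (2 ℕ.+ ⌈ ℕ.suc k /2⌉) (U k (+ ⌊ 3 ℕ.+ 3 ℕ.* k /2⌋) ∷ [])
       × (∀ i → 2 ℕ.+ ⌈ ℕ.suc k /2⌉ < i → Sph k i []))
    -- (iv) k even
    × (k % 2 ≡ 0 →
         Sph k (ℕ.suc ⌈ ℕ.suc k /2⌉) (U± k (+ ⌊ 2 ℕ.+ 3 ℕ.* k /2⌋))
       × (∀ i → ℕ.suc ⌈ ℕ.suc k /2⌉ < i → Sph k i []))
lemma4p5 k 13≤k =
  ( from-13 Sphere₁ Level₁.sphere k 13≤k , from-13 Sphere₂ Level₂.sphere k 13≤k , from-13 Sphere₃ Level₃.sphere k 13≤k
  , from-13 Sphere₄ Level₄.sphere k 13≤k , from-13 Sphere₅ Level₅.sphere k 13≤k )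
  , (λ i 6≤i i≤b → let a , q , 6+a≡i , K≡k = middle-view 6≤i i≤b in subst₂ SphereMiddle K≡k 6+a≡i (Middle.sphere a q))
  , (λ odd → let c , K≡k = odd-view 13≤k odd in subst SpheresOdd K≡k (Odd.spheres c))
  , (λ even → let c , K≡k = even-view 13≤k even in subst SpheresEven K≡k (Even.spheres c))
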